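{- Let $k\ge 2$ be an integer and let $G=\Theta(2,2,2k)$. Then $P_\ell(G,m)=P(G,m)$ for every integer $m\ge 3$.
   Context: $\Theta(l_1,l_2,l_3)$ denotes the graph consisting of two end vertices joined by three internally disjoint paths of lengths $l_1,l_2,l_3$. For a list assignment $L$ of a graph $G$, $P(G,L)$ is the number of proper colorings $f$ with $f(v)\in L(v)$ for all $v$; an $m$-assignment has all lists of size $m$; $P_\ell(G,m)$ is the minimum of $P(G,L)$ over all $m$-assignments $L$; $P(G,m)$ is the chromatic polynomial. -}

module Defs where

open import Data.Nat using (ℕ; zero; suc; _+_; _∸_; _<_; _≟_)
open import Data.Product using (_×_; _,_)
open import Data.List using (List; []; _∷_; [_]; map; concatMap; length; filter; upTo; _++_)
open import Data.List.Relation.Unary.All using (All; all?)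
open import Data.List.Relation.Unary.Unique.Propositional using (Unique)
open import Relation.Binary.PropositionalEquality using (_≡_; _≢_)
open import Relation.Nullary using (¬?)
open import Relation.Unary using (Decidable)

-- A finite (multi)graph on vertex set {0, …, n-1}, given by an edge list.
record Graph : Set where
  constructor graph
  field
    n     : ℕ
    edges : List (ℕ × ℕ)
open Graph public

chain : List ℕ → List (ℕ × ℕ)
chain (x ∷ y ∷ xs) = (x , y) ∷ chain (y ∷ xs)
chain _            = []

-- Path of length l from vertex 0 to vertex 1 whose l-1 internal vertices
-- are s, s+1, …, s+l-2.
pathEdges : ℕ → ℕ → List (ℕ × ℕ)
pathEdges s l = chain (0 ∷ (map (s +_) (upTo (l ∸ 1)) ++ [ 1 ]))

-- Θ(l₁,l₂,l₃): end vertices 0 and 1 joined by three internally disjoint paths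
-- of lengths l₁, l₂, l₃ (lengths assumed ≥ 1).
Θ : ℕ → ℕ → ℕ → Graph
Θ l₁ l₂ l₃ = graph (2 + (l₁ ∸ 1) + (l₂ ∸ 1) + (l₃ ∸ 1))
  (pathEdges 2 l₁ ++ pathEdges (2 + (l₁ ∸ 1)) l₂
    ++ pathEdges (2 + (l₁ ∸ 1) + (l₂ ∸ 1)) l₃)

-- A colouring of vertices 0..n-1 is the list of their colours (index i = colour of vertex i).
colourOf : List ℕ → ℕ → ℕ
colourOf []       _       = 0
colourOf (c ∷ cs) zero    = c
colourOf (c ∷ cs) (suc i) = colourOf cs i

Proper : List (ℕ × ℕ) → List ℕ → Set
Proper es c = All (λ { (i , j) → colourOf c i ≢ colourOf c j }) es

proper? : (es : List (ℕ × ℕ)) → Decidable (Proper es)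
proper? es c = all? (λ { (i , j) → ¬? (colourOf c i ≟ colourOf c j) }) es

choices : List (List ℕ) → List (List ℕ)
choices []       = [ [] ]
choices (l ∷ ls) = concatMap (λ x → map (x ∷_) (choices ls)) l

ListAssignment : Set
ListAssignment = ℕ → List ℕ

IsMAssignment : Graph → ℕ → ListAssignment → Set
IsMAssignment G m L = ∀ i → i < n G → Unique (L i) × length (L i) ≡ m

P-list : Graph → ListAssignment → ℕ
P-list G L = length (filter (proper? (edges G)) (choices (map L (upTo (n G)))))

P-chrom : Graph → ℕ → ℕ
P-chrom G m = P-list G (λ _ → upTo m)

-- x is the value P_ℓ(G,m) = min { P(G,L) : L an m-assignment of G }.
IsListColorFn : Graph → ℕ → ℕ → Set
IsListColorFn G m x =
  (∀ L → IsMAssignment G m L → x Data.Nat.≤ P-list G L)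
  × (Data.Product.Σ ListAssignment λ L → IsMAssignment G m L × P-list G L ≡ x)

module Submission where

-- Write m = q + 2. Colouring the two end vertices first, for every list assignment L
--   P(Θ(2,2,2k), L) = ∑_{c ∈ L(0)} ∑_{d ∈ L(1)} |L(2) ∖ {c,d}| · |L(3) ∖ {c,d}| · W(c,d),
-- where W(c,d) counts the colourings of the long path whose ends are coloured c and d.
-- For an m-list, |L(j) ∖ {c,d}| = q + e with an excess e ≥ [c = d], and e > [c = d] only
-- when c or d is missing from L(j). For the constant assignment e = [c = d] and
-- W(c,d) = α + [c = d] for a number α = α(q,k), which gives P(Θ,m) in closed form.
-- For an arbitrary m-assignment, (q + e)(q + e′) ≥ q² + q(e + e′) + [c = d] splits
-- P(Θ,L) into sums that are bounded below by induction along the long path, two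
-- vertices at a time: W ≥ α pointwise, the sum of W over one free end is at least
-- (q + 1)^(2k) = mα + 1, and ∑_c W(c,c) ≥ m(α + 1). When colours are missing the last
-- bound weakens, but every missing colour contributes an excess term of size about
-- mα + 1, which makes up for it as soon as q ≥ 1 and α ≥ 3, that is m ≥ 3 and k ≥ 2.

open import Defs
open import Data.Bool using (true; false)
open import Data.Empty using (⊥-elim)
open import Data.List using (List; []; _∷_; [_]; _++_; length; map; filter; upTo; applyUpTo)
open import Data.List.Membership.Propositional using (_∈_)
open import Data.List.Properties
  using (filter-++; filter-none; length-++; length-upTo; length-applyUpTo; map-∘; map-applyUpTo)
open import Data.List.Relation.Unary.All using (All; []; _∷_; tabulate)
open import Data.List.Relation.Unary.All.Properties using (applyUpTo⁺₁; applyUpTo⁺₂)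
open import Data.List.Relation.Unary.AllPairs using (_∷_)
open import Data.List.Relation.Unary.Any using (here; there)
open import Data.List.Relation.Unary.Unique.Propositional using (Unique)
open import Data.List.Relation.Unary.Unique.Propositional.Properties using (upTo⁺)
open import Data.Nat using (ℕ; _≤_; _*_; zero; suc; _+_; _∸_; _^_; _≟_; z≤n; s≤s; z<s; s<s)
open import Data.Nat.Properties
open import Data.Nat.Tactic.RingSolver using (solve-∀)
open import Data.Product using (_×_; _,_; proj₁; proj₂)
open import Data.Sum using (_⊎_; inj₁; inj₂)
open import Function using (_∘_)
open import Function.Bundles using (_⇔_; mk⇔; Equivalence)
open import Relation.Binary.PropositionalEquality hiding ([_])
open import Relation.Nullary using (Dec; yes; no; ¬_; ¬?; does)
open import Relation.Nullary.Decidable using (_×-dec_)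
open import Relation.Unary using (Decidable)

-- Sums over lists

∑ : List ℕ → (ℕ → ℕ) → ℕ
∑ []       f = 0
∑ (x ∷ xs) f = f x + ∑ xs f

syntax ∑ l (λ x → e) = ∑[ x ∈ l ] e

∑-cong : ∀ l {f g : ℕ → ℕ} → (∀ x → f x ≡ g x) → ∑ l f ≡ ∑ l g
∑-cong []      f≗g = refl
∑-cong (x ∷ l) f≗g = cong₂ _+_ (f≗g x) (∑-cong l f≗g)

∑-cong-∈ : ∀ l {f g : ℕ → ℕ} → (∀ {x} → x ∈ l → f x ≡ g x) → ∑ l f ≡ ∑ l g
∑-cong-∈ []      f≗g = refl
∑-cong-∈ (x ∷ l) f≗g = cong₂ _+_ (f≗g (here refl)) (∑-cong-∈ l (f≗g ∘ there))

∑-mono-≤ : ∀ l {f g : ℕ → ℕ} → (∀ x → f x ≤ g x) → ∑ l f ≤ ∑ l g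
∑-mono-≤ []      f≤g = z≤n
∑-mono-≤ (x ∷ l) f≤g = +-mono-≤ (f≤g x) (∑-mono-≤ l f≤g)

∑-distrib-+ : ∀ l (f g : ℕ → ℕ) → ∑[ x ∈ l ] (f x + g x) ≡ ∑ l f + ∑ l g
∑-distrib-+ []      f g = refl
∑-distrib-+ (x ∷ l) f g = begin
  f x + g x + ∑[ x ∈ l ] (f x + g x) ≡⟨ cong (f x + g x +_) (∑-distrib-+ l f g) ⟩
  f x + g x + (∑ l f + ∑ l g)         ≡⟨ interchange (f x) (g x) (∑ l f) (∑ l g) ⟩
  f x + ∑ l f + (g x + ∑ l g)         ∎
  where
  open ≡-Reasoning
  interchange : ∀ a b c d → a + b + (c + d) ≡ a + c + (b + d)
  interchange = solve-∀

∑-distrib-+₃ : ∀ l (f g h : ℕ → ℕ) → ∑[ x ∈ l ] (f x + g x + h x) ≡ ∑ l f + ∑ l g + ∑ l h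
∑-distrib-+₃ l f g h =
  trans (∑-distrib-+ l (λ x → f x + g x) h) (cong (_+ ∑ l h) (∑-distrib-+ l f g))

∑-*ˡ : ∀ l k (f : ℕ → ℕ) → ∑[ x ∈ l ] (k * f x) ≡ k * ∑ l f
∑-*ˡ []      k f = sym (*-zeroʳ k)
∑-*ˡ (x ∷ l) k f = trans (cong (k * f x +_) (∑-*ˡ l k f)) (sym (*-distribˡ-+ k (f x) (∑ l f)))

∑-*ʳ : ∀ l k (f : ℕ → ℕ) → ∑[ x ∈ l ] (f x * k) ≡ ∑ l f * k
∑-*ʳ l k f = trans (∑-cong l (λ x → *-comm (f x) k)) (trans (∑-*ˡ l k f) (*-comm k (∑ l f)))

∑-const : ∀ l k → ∑[ _ ∈ l ] k ≡ length l * k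
∑-const []      k = refl
∑-const (x ∷ l) k = cong (k +_) (∑-const l k)

∑-comm : ∀ l l′ (f : ℕ → ℕ → ℕ) → ∑[ x ∈ l ] ∑[ y ∈ l′ ] f x y ≡ ∑[ y ∈ l′ ] ∑[ x ∈ l ] f x y
∑-comm []      l′ f = sym (trans (∑-const l′ 0) (*-zeroʳ (length l′)))
∑-comm (x ∷ l) l′ f = begin
  ∑ l′ (f x) + ∑[ x ∈ l ] ∑ l′ (f x)           ≡⟨ cong (∑ l′ (f x) +_) (∑-comm l l′ f) ⟩
  ∑ l′ (f x) + ∑[ y ∈ l′ ] ∑[ x ∈ l ] f x y    ≡⟨ ∑-distrib-+ l′ (f x) _ ⟨
  ∑[ y ∈ l′ ] (f x y + ∑[ x ∈ l ] f x y)       ∎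
  where open ≡-Reasoning

∑∑-distrib-+ : ∀ U V (f g : ℕ → ℕ → ℕ) →
               ∑[ c ∈ U ] ∑[ d ∈ V ] (f c d + g c d) ≡ ∑[ c ∈ U ] ∑ V (f c) + ∑[ c ∈ U ] ∑ V (g c)
∑∑-distrib-+ U V f g = trans (∑-cong U (λ c → ∑-distrib-+ V (f c) (g c))) (∑-distrib-+ U _ _)

∑∑-*ˡ : ∀ U V k (f : ℕ → ℕ → ℕ) → ∑[ c ∈ U ] ∑[ d ∈ V ] (k * f c d) ≡ k * ∑[ c ∈ U ] ∑ V (f c)
∑∑-*ˡ U V k f = trans (∑-cong U (λ c → ∑-*ˡ V k (f c))) (∑-*ˡ U k _)

length*≤∑ : ∀ l k (g : ℕ → ℕ) → (∀ x → k ≤ g x) → length l * k ≤ ∑ l g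
length*≤∑ l k g k≤g = ≤-trans (≤-reflexive (sym (∑-const l k))) (∑-mono-≤ l k≤g)

∑*≤∑* : ∀ l k (f g : ℕ → ℕ) → (∀ x → k ≤ g x) → ∑ l f * k ≤ ∑[ x ∈ l ] (f x * g x)
∑*≤∑* l k f g k≤g =
  ≤-trans (≤-reflexive (sym (∑-*ʳ l k f))) (∑-mono-≤ l (λ x → *-monoʳ-≤ (f x) (k≤g x)))

∑≡0⇒∑*≡0 : ∀ l (g f : ℕ → ℕ) → ∑ l g ≡ 0 → ∑[ x ∈ l ] (g x * f x) ≡ 0
∑≡0⇒∑*≡0 []      g f _   = refl
∑≡0⇒∑*≡0 (x ∷ l) g f ∑≡0 =
  cong₂ _+_ (cong (_* f x) (m+n≡0⇒m≡0 (g x) ∑≡0)) (∑≡0⇒∑*≡0 l g f (m+n≡0⇒n≡0 (g x) ∑≡0))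

-- Indicators and multiplicities

𝟙 : ∀ {P : Set} → Dec P → ℕ
𝟙 (yes _) = 1
𝟙 (no _)  = 0

𝟙-yes : ∀ {P : Set} (P? : Dec P) → P → 𝟙 P? ≡ 1
𝟙-yes (yes _) _  = refl
𝟙-yes (no ¬p) p  = ⊥-elim (¬p p)

𝟙-no : ∀ {P : Set} (P? : Dec P) → ¬ P → 𝟙 P? ≡ 0
𝟙-no (yes p) ¬p = ⊥-elim (¬p p)
𝟙-no (no _)  _  = refl

𝟙-×-dec : ∀ {A B : Set} (A? : Dec A) (B? : Dec B) → 𝟙 (A? ×-dec B?) ≡ 𝟙 A? * 𝟙 B?
𝟙-×-dec (yes _) (yes _) = refl
𝟙-×-dec (yes _) (no _)  = refl
𝟙-×-dec (no _)  (yes _) = refl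
𝟙-×-dec (no _)  (no _)  = refl

𝟙-cong : ∀ {A B : Set} → A ⇔ B → (A? : Dec A) (B? : Dec B) → 𝟙 A? ≡ 𝟙 B?
𝟙-cong A⇔B (yes _) (yes _) = refl
𝟙-cong A⇔B (no _)  (no _)  = refl
𝟙-cong A⇔B (yes a) (no ¬b) = ⊥-elim (¬b (Equivalence.to A⇔B a))
𝟙-cong A⇔B (no ¬a) (yes b) = ⊥-elim (¬a (Equivalence.from A⇔B b))

δ : ℕ → ℕ → ℕ
δ x y = 𝟙 (x ≟ y)

δᶜ : ℕ → ℕ → ℕ
δᶜ x y = 𝟙 (¬? (x ≟ y))

data δ-View (x y : ℕ) : Set where
  equal    : x ≡ y → δ x y ≡ 1 → δᶜ x y ≡ 0 → δ-View x y
  distinct : x ≢ y → δ x y ≡ 0 → δᶜ x y ≡ 1 → δ-View x y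

δ-view : ∀ x y → δ-View x y
δ-view x y with x ≟ y
... | yes x≡y = equal x≡y (𝟙-yes (x ≟ y) x≡y) (𝟙-no (¬? (x ≟ y)) (λ x≢y → x≢y x≡y))
... | no x≢y  = distinct x≢y (𝟙-no (x ≟ y) x≢y) (𝟙-yes (¬? (x ≟ y)) x≢y)

δ-refl : ∀ x → δ x x ≡ 1
δ-refl x with δ-view x x
... | equal _ δ≡1 _     = δ≡1
... | distinct x≢x _ _  = ⊥-elim (x≢x refl)

δ-sym : ∀ x y → δ x y ≡ δ y x
δ-sym x y with δ-view x y | δ-view y x
... | equal _ p _     | equal _ q _     = trans p (sym q)
... | distinct _ p _  | distinct _ q _  = trans p (sym q)
... | equal x≡y _ _   | distinct y≢x _ _ = ⊥-elim (y≢x (sym x≡y))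
... | distinct x≢y _ _ | equal y≡x _ _  = ⊥-elim (x≢y (sym y≡x))

δᶜ-sym : ∀ x y → δᶜ x y ≡ δᶜ y x
δᶜ-sym x y with δ-view x y | δ-view y x
... | equal _ _ p     | equal _ _ q     = trans p (sym q)
... | distinct _ _ p  | distinct _ _ q  = trans p (sym q)
... | equal x≡y _ _   | distinct y≢x _ _ = ⊥-elim (y≢x (sym x≡y))
... | distinct x≢y _ _ | equal y≡x _ _  = ⊥-elim (x≢y (sym y≡x))

δ+δᶜ≡1 : ∀ x y → δ x y + δᶜ x y ≡ 1
δ+δᶜ≡1 x y with δ-view x y
... | equal _ p q    = cong₂ _+_ p q
... | distinct _ p q = cong₂ _+_ p q

δ≤1 : ∀ x y → δ x y ≤ 1
δ≤1 x y = m+n≤o⇒m≤o (δ x y) (≤-reflexive (δ+δᶜ≡1 x y))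

δ*δ≡δ : ∀ x y → δ x y * δ x y ≡ δ x y
δ*δ≡δ x y with δ-view x y
... | equal _ p _    rewrite p = refl
... | distinct _ p _ rewrite p = refl

δ*-subst : ∀ x y (f : ℕ → ℕ) → δ x y * f y ≡ δ x y * f x
δ*-subst x y f with δ-view x y
... | equal refl _ _  = refl
... | distinct _ p _  rewrite p = refl

δᶜ*δᶜ+δ+δ : ∀ c x y → δᶜ c x * δᶜ x y + δ c x + δ x y ≡ 1 + δ c x * δ c y
δᶜ*δᶜ+δ+δ c x y with δ-view c x | δ-view x y
... | equal refl p q | _ rewrite p | q = cong suc (sym (+-identityʳ (δ c y)))
... | distinct _ p q | equal refl r s rewrite p | q | r | s = refl
... | distinct _ p q | distinct _ r s rewrite p | q | r | s = refl

occ : ℕ → List ℕ → ℕ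
occ x l = ∑[ y ∈ l ] δ x y

occᶜ : ℕ → List ℕ → ℕ
occᶜ x l = 1 ∸ occ x l

∣_∖_∣ : List ℕ → List ℕ → ℕ
∣ P ∖ Q ∣ = ∑[ x ∈ P ] occᶜ x Q

∣_∩_∣ : List ℕ → List ℕ → ℕ
∣ P ∩ Q ∣ = ∑[ x ∈ P ] occ x Q

∣_∩_∩_∣ : List ℕ → List ℕ → List ℕ → ℕ
∣ P ∩ Q ∩ R ∣ = ∑[ x ∈ P ] (occ x Q * occ x R)

occ-∉ : ∀ x l → All (x ≢_) l → occ x l ≡ 0
occ-∉ x []      []           = refl
occ-∉ x (y ∷ l) (x≢y ∷ x∉l) with δ-view x y
... | equal x≡y _ _ = ⊥-elim (x≢y x≡y)
... | distinct _ p _ rewrite p = occ-∉ x l x∉l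

occ≤1 : ∀ x l → Unique l → occ x l ≤ 1
occ≤1 x []      _ = z≤n
occ≤1 x (y ∷ l) (y∉l ∷ uniq) with δ-view x y
... | equal refl p _ rewrite p | occ-∉ x l y∉l = ≤-refl
... | distinct _ p _ rewrite p = occ≤1 x l uniq

occ*≤ : ∀ x l n → Unique l → occ x l * n ≤ n
occ*≤ x l n uniq = ≤-trans (*-monoˡ-≤ n (occ≤1 x l uniq)) (≤-reflexive (*-identityˡ n))

occ+occᶜ≡1 : ∀ x l → Unique l → occ x l + occᶜ x l ≡ 1
occ+occᶜ≡1 x l uniq = m+[n∸m]≡n (occ≤1 x l uniq)

occ≡1⊎occᶜ≡1 : ∀ x l → Unique l → (occ x l ≡ 1 × occᶜ x l ≡ 0) ⊎ (occ x l ≡ 0 × occᶜ x l ≡ 1)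
occ≡1⊎occᶜ≡1 x l uniq with occ x l | occ≤1 x l uniq
... | zero  | _ = inj₂ (refl , refl)
... | suc _ | s≤s z≤n = inj₁ (refl , refl)

∈⇒occ≡1 : ∀ {x} l → Unique l → x ∈ l → occ x l ≡ 1
∈⇒occ≡1 l uniq x∈l = ≤-antisym (occ≤1 _ l uniq) (∈⇒1≤occ l x∈l)
  where
  ∈⇒1≤occ : ∀ {x} l → x ∈ l → 1 ≤ occ x l
  ∈⇒1≤occ {x} (_ ∷ l) (here refl) = ≤-trans (≤-reflexive (sym (δ-refl x))) (m≤m+n (δ x x) _)
  ∈⇒1≤occ {x} (y ∷ l) (there x∈l) = ≤-trans (∈⇒1≤occ l x∈l) (m≤n+m _ (δ x y))

∑δ*≡occ* : ∀ l c (f : ℕ → ℕ) → ∑[ y ∈ l ] (δ c y * f y) ≡ occ c l * f c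
∑δ*≡occ* l c f = trans (∑-cong l (λ y → δ*-subst c y f)) (∑-*ʳ l (f c) (δ c))

occ*≤∑ : ∀ l c (f : ℕ → ℕ) → occ c l * f c ≤ ∑ l f
occ*≤∑ l c f = begin
  occ c l * f c             ≡⟨ ∑δ*≡occ* l c f ⟨
  ∑[ y ∈ l ] (δ c y * f y)  ≤⟨ ∑-mono-≤ l (λ y → ≤-trans (*-monoˡ-≤ (f y) (δ≤1 c y)) (≤-reflexive (*-identityˡ (f y)))) ⟩
  ∑ l f                     ∎
  where open ≤-Reasoning

∑δᶜ+occ≡length : ∀ l c → ∑ l (δᶜ c) + occ c l ≡ length l
∑δᶜ+occ≡length l c = begin
  ∑ l (δᶜ c) + ∑ l (δ c)            ≡⟨ ∑-distrib-+ l (δᶜ c) (δ c) ⟨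
  ∑[ x ∈ l ] (δᶜ c x + δ c x)       ≡⟨ ∑-cong l (λ x → trans (+-comm (δᶜ c x) (δ c x)) (δ+δᶜ≡1 c x)) ⟩
  ∑[ _ ∈ l ] 1                      ≡⟨ ∑-const l 1 ⟩
  length l * 1                      ≡⟨ *-identityʳ _ ⟩
  length l                          ∎
  where open ≡-Reasoning

∣∩∣+∣∖∣≡length : ∀ P Q → Unique Q → ∣ P ∩ Q ∣ + ∣ P ∖ Q ∣ ≡ length P
∣∩∣+∣∖∣≡length P Q uQ = begin
  ∣ P ∩ Q ∣ + ∣ P ∖ Q ∣             ≡⟨ ∑-distrib-+ P _ _ ⟨
  ∑[ x ∈ P ] (occ x Q + occᶜ x Q)   ≡⟨ ∑-cong P (λ x → occ+occᶜ≡1 x Q uQ) ⟩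
  ∑[ _ ∈ P ] 1                      ≡⟨ ∑-const P 1 ⟩
  length P * 1                      ≡⟨ *-identityʳ _ ⟩
  length P                          ∎
  where open ≡-Reasoning

∣∩∣-comm : ∀ P Q → ∣ P ∩ Q ∣ ≡ ∣ Q ∩ P ∣
∣∩∣-comm P Q = trans (∑-comm P Q δ) (∑-cong Q (λ y → ∑-cong P (λ x → δ-sym x y)))

∣∖∣-comm : ∀ P Q → Unique P → Unique Q → length P ≡ length Q → ∣ P ∖ Q ∣ ≡ ∣ Q ∖ P ∣
∣∖∣-comm P Q uP uQ |P|≡|Q| = +-cancelˡ-≡ ∣ P ∩ Q ∣ _ _ (begin
  ∣ P ∩ Q ∣ + ∣ P ∖ Q ∣  ≡⟨ ∣∩∣+∣∖∣≡length P Q uQ ⟩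
  length P               ≡⟨ |P|≡|Q| ⟩
  length Q               ≡⟨ ∣∩∣+∣∖∣≡length Q P uP ⟨
  ∣ Q ∩ P ∣ + ∣ Q ∖ P ∣  ≡⟨ cong (_+ ∣ Q ∖ P ∣) (∣∩∣-comm Q P) ⟩
  ∣ P ∩ Q ∣ + ∣ Q ∖ P ∣  ∎)
  where open ≡-Reasoning

∑occ*≤∑ : ∀ P Q (f : ℕ → ℕ) → Unique P → ∑[ c ∈ P ] (occ c Q * f c) ≤ ∑ Q f
∑occ*≤∑ P Q f uP = begin
  ∑[ c ∈ P ] (occ c Q * f c)              ≡⟨ ∑-cong P (λ c → ∑δ*≡occ* Q c f) ⟨
  ∑[ c ∈ P ] ∑[ x ∈ Q ] (δ c x * f x)     ≡⟨ ∑-comm P Q (λ c x → δ c x * f x) ⟩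
  ∑[ x ∈ Q ] ∑[ c ∈ P ] (δ c x * f x)
    ≡⟨ ∑-cong Q (λ x → trans (∑-*ʳ P (f x) (λ c → δ c x)) (cong (_* f x) (∑-cong P (λ c → δ-sym c x)))) ⟩
  ∑[ x ∈ Q ] (occ x P * f x)              ≤⟨ ∑-mono-≤ Q (λ x → occ*≤ x P (f x) uP) ⟩
  ∑ Q f                                   ∎
  where open ≤-Reasoning

∣∖∣≡0⇒∑occ*≡∑ : ∀ P Q (f : ℕ → ℕ) → Unique Q → ∣ P ∖ Q ∣ ≡ 0 → ∑[ c ∈ P ] (occ c Q * f c) ≡ ∑ P f
∣∖∣≡0⇒∑occ*≡∑ P Q f uQ P⊆Q = sym (begin
  ∑ P f
    ≡⟨ ∑-cong P (λ c → sym (trans (cong (_* f c) (occ+occᶜ≡1 c Q uQ)) (*-identityˡ (f c)))) ⟩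
  ∑[ c ∈ P ] ((occ c Q + occᶜ c Q) * f c)                    ≡⟨ ∑-cong P (λ c → *-distribʳ-+ (f c) (occ c Q) (occᶜ c Q)) ⟩
  ∑[ c ∈ P ] (occ c Q * f c + occᶜ c Q * f c)                ≡⟨ ∑-distrib-+ P _ _ ⟩
  ∑[ c ∈ P ] (occ c Q * f c) + ∑[ c ∈ P ] (occᶜ c Q * f c)   ≡⟨ cong (∑[ c ∈ P ] (occ c Q * f c) +_) (∑≡0⇒∑*≡0 P _ f P⊆Q) ⟩
  ∑[ c ∈ P ] (occ c Q * f c) + 0                             ≡⟨ +-identityʳ _ ⟩
  ∑[ c ∈ P ] (occ c Q * f c)                                 ∎)
  where open ≡-Reasoning

length≤∣∖∣+∣∖∣+∣∩∩∣ : ∀ P Q R → Unique P → Unique Q → Unique R → length Q ≡ length R →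
                      length P ≤ ∣ P ∖ Q ∣ + ∣ R ∖ Q ∣ + ∣ P ∩ Q ∩ R ∣
length≤∣∖∣+∣∖∣+∣∩∩∣ P Q R uP uQ uR |Q|≡|R| = begin
  length P                                         ≡⟨ ∣∩∣+∣∖∣≡length P Q uQ ⟨
  ∣ P ∩ Q ∣ + ∣ P ∖ Q ∣                            ≡⟨ +-comm ∣ P ∩ Q ∣ _ ⟩
  ∣ P ∖ Q ∣ + ∣ P ∩ Q ∣                            ≡⟨ cong (∣ P ∖ Q ∣ +_) split ⟩
  ∣ P ∖ Q ∣ + (∣ P ∩ Q ∩ R ∣ + ∣P∩Q∖R∣)             ≤⟨ +-monoʳ-≤ ∣ P ∖ Q ∣ (+-monoʳ-≤ ∣ P ∩ Q ∩ R ∣ ∣P∩Q∖R∣≤∣R∖Q∣) ⟩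
  ∣ P ∖ Q ∣ + (∣ P ∩ Q ∩ R ∣ + ∣ R ∖ Q ∣)           ≡⟨ rearrange ∣ P ∖ Q ∣ _ _ ⟩
  ∣ P ∖ Q ∣ + ∣ R ∖ Q ∣ + ∣ P ∩ Q ∩ R ∣            ∎
  where
  open ≤-Reasoning
  ∣P∩Q∖R∣ = ∑[ c ∈ P ] (occ c Q * occᶜ c R)
  rearrange : ∀ a b c → a + (b + c) ≡ a + c + b
  rearrange = solve-∀
  split : ∣ P ∩ Q ∣ ≡ ∣ P ∩ Q ∩ R ∣ + ∣P∩Q∖R∣
  split = trans (∑-cong P (λ c → trans (sym (*-identityʳ (occ c Q)))
                   (trans (cong (occ c Q *_) (sym (occ+occᶜ≡1 c R uR))) (*-distribˡ-+ (occ c Q) (occ c R) (occᶜ c R)))))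
                (∑-distrib-+ P _ _)
  ∣P∩Q∖R∣≤∣R∖Q∣ : ∣P∩Q∖R∣ ≤ ∣ R ∖ Q ∣
  ∣P∩Q∖R∣≤∣R∖Q∣ = ≤-trans (∑occ*≤∑ P Q (λ c → occᶜ c R) uP) (≤-reflexive (∣∖∣-comm Q R uQ uR |Q|≡|R|))

-- Colourings of paths

walks : ℕ → List (List ℕ) → ℕ → ℕ
walks c []       d = δᶜ c d
walks c (l ∷ ls) d = ∑[ x ∈ l ] (δᶜ c x * walks x ls d)

avoiding : List ℕ → ℕ → ℕ → ℕ
avoiding l c d = walks c [ l ] d

excess : List ℕ → ℕ → ℕ → ℕ
excess l c d = occᶜ c l + occᶜ d l + δ c d * occ c l

Palette : ℕ → List ℕ → Set
Palette m l = Unique l × length l ≡ m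

avoiding≡q+excess : ∀ q l c d → Palette (2 + q) l → avoiding l c d ≡ q + excess l c d
avoiding≡q+excess q l c d (uniq , |l|≡2+q) = +-cancelʳ-≡ (oc + od) _ _ (begin
  avoiding l c d + (oc + od)                      ≡⟨ counted ⟩
  2 + q + oc * δ c d
    ≡⟨ cong (λ two → two + q + oc * δ c d) (sym (cong₂ _+_ (occ+occᶜ≡1 c l uniq) (occ+occᶜ≡1 d l uniq))) ⟩
  (oc + occᶜ c l) + (od + occᶜ d l) + q + oc * δ c d   ≡⟨ regroup oc (occᶜ c l) od (occᶜ d l) q (δ c d) ⟩
  q + excess l c d + (oc + od)                    ∎)
  where
  open ≡-Reasoning
  oc = occ c l
  od = occ d l
  regroup : ∀ a a′ b b′ q e → (a + a′) + (b + b′) + q + a * e ≡ q + (a′ + b′ + e * a) + (a + b)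
  regroup = solve-∀
  counted : avoiding l c d + (oc + od) ≡ 2 + q + oc * δ c d
  counted = begin
    avoiding l c d + (oc + od)                              ≡⟨ cong (λ z → avoiding l c d + (oc + z)) (∑-cong l (λ x → δ-sym d x)) ⟩
    avoiding l c d + (oc + ∑[ x ∈ l ] δ x d)                ≡⟨ +-assoc (avoiding l c d) oc _ ⟨
    avoiding l c d + oc + ∑[ x ∈ l ] δ x d                  ≡⟨ cong (_+ ∑[ x ∈ l ] δ x d) (∑-distrib-+ l _ _) ⟨
    ∑[ x ∈ l ] (δᶜ c x * δᶜ x d + δ c x) + ∑[ x ∈ l ] δ x d ≡⟨ ∑-distrib-+ l _ _ ⟨
    ∑[ x ∈ l ] (δᶜ c x * δᶜ x d + δ c x + δ x d)            ≡⟨ ∑-cong l (λ x → δᶜ*δᶜ+δ+δ c x d) ⟩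
    ∑[ x ∈ l ] (1 + δ c x * δ c d)                          ≡⟨ ∑-distrib-+ l (λ _ → 1) _ ⟩
    ∑[ _ ∈ l ] 1 + ∑[ x ∈ l ] (δ c x * δ c d)
      ≡⟨ cong₂ _+_ (trans (∑-const l 1) (trans (*-identityʳ _) |l|≡2+q)) (∑-*ʳ l (δ c d) (δ c)) ⟩
    2 + q + oc * δ c d                                      ∎

excess≥δ : ∀ l c d → Unique l → δ c d ≤ excess l c d
excess≥δ l c d uniq with δ-view c d
... | distinct _ p _ = ≤-trans (≤-reflexive p) z≤n
... | equal refl p _ = begin
  δ c c                                    ≡⟨ p ⟩
  1                                        ≡⟨ occ+occᶜ≡1 c l uniq ⟨
  occ c l + occᶜ c l                       ≡⟨ +-comm (occ c l) _ ⟩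
  occᶜ c l + occ c l
    ≤⟨ +-mono-≤ (m≤n+m (occᶜ c l) (occᶜ c l)) (≤-reflexive (sym (trans (cong (_* occ c l) p) (*-identityˡ (occ c l))))) ⟩
  excess l c c                             ∎
  where open ≤-Reasoning

walks-∷∷ : ∀ c l₁ l₂ ls d → walks c (l₁ ∷ l₂ ∷ ls) d ≡ ∑[ y ∈ l₂ ] (walks y ls d * avoiding l₁ c y)
walks-∷∷ c l₁ l₂ ls d = begin
  ∑[ x ∈ l₁ ] (δᶜ c x * ∑[ y ∈ l₂ ] (δᶜ x y * walks y ls d))   ≡⟨ ∑-cong l₁ (λ x → ∑-*ˡ l₂ (δᶜ c x) _) ⟨
  ∑[ x ∈ l₁ ] ∑[ y ∈ l₂ ] (δᶜ c x * (δᶜ x y * walks y ls d))   ≡⟨ ∑-comm l₁ l₂ _ ⟩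
  ∑[ y ∈ l₂ ] ∑[ x ∈ l₁ ] (δᶜ c x * (δᶜ x y * walks y ls d))
    ≡⟨ ∑-cong l₂ (λ y → trans (∑-cong l₁ (λ x → sym (*-assoc (δᶜ c x) (δᶜ x y) _))) (∑-*ʳ l₁ _ _)) ⟩
  ∑[ y ∈ l₂ ] (avoiding l₁ c y * walks y ls d)                 ≡⟨ ∑-cong l₂ (λ y → *-comm (avoiding l₁ c y) _) ⟩
  ∑[ y ∈ l₂ ] (walks y ls d * avoiding l₁ c y)                 ∎
  where open ≡-Reasoning

walks-∷∷-excess : ∀ q c l₁ l₂ ls d → Palette (2 + q) l₁ →
  walks c (l₁ ∷ l₂ ∷ ls) d ≡ q * ∑[ y ∈ l₂ ] walks y ls d + ∑[ y ∈ l₂ ] (walks y ls d * excess l₁ c y)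
walks-∷∷-excess q c l₁ l₂ ls d pal₁ = begin
  walks c (l₁ ∷ l₂ ∷ ls) d                                              ≡⟨ walks-∷∷ c l₁ l₂ ls d ⟩
  ∑[ y ∈ l₂ ] (walks y ls d * avoiding l₁ c y)
    ≡⟨ ∑-cong l₂ (λ y → cong (walks y ls d *_) (avoiding≡q+excess q l₁ c y pal₁)) ⟩
  ∑[ y ∈ l₂ ] (walks y ls d * (q + excess l₁ c y))                      ≡⟨ ∑-cong l₂ (λ y → distrib (walks y ls d) q (excess l₁ c y)) ⟩
  ∑[ y ∈ l₂ ] (q * walks y ls d + walks y ls d * excess l₁ c y)         ≡⟨ ∑-distrib-+ l₂ _ _ ⟩
  ∑[ y ∈ l₂ ] (q * walks y ls d) + ∑[ y ∈ l₂ ] (walks y ls d * excess l₁ c y)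
                                                                        ≡⟨ cong (_+ _) (∑-*ˡ l₂ q _) ⟩
  q * ∑[ y ∈ l₂ ] walks y ls d + ∑[ y ∈ l₂ ] (walks y ls d * excess l₁ c y) ∎
  where
  open ≡-Reasoning
  distrib : ∀ w q e → w * (q + e) ≡ q * w + w * e
  distrib = solve-∀

1+q≤∑δᶜ : ∀ q l c → Palette (2 + q) l → 1 + q ≤ ∑ l (δᶜ c)
1+q≤∑δᶜ q l c (uniq , |l|≡2+q) = +-cancelʳ-≤ (occ c l) (1 + q) (∑ l (δᶜ c)) (begin
  1 + q + occ c l      ≤⟨ +-monoʳ-≤ (1 + q) (occ≤1 c l uniq) ⟩
  1 + q + 1            ≡⟨ +-comm (1 + q) 1 ⟩
  2 + q                ≡⟨ |l|≡2+q ⟨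
  length l             ≡⟨ ∑δᶜ+occ≡length l c ⟨
  ∑ l (δᶜ c) + occ c l ∎)
  where open ≤-Reasoning

∑-walksˡ-≥ : ∀ q l ls d → Palette (2 + q) l → All (Palette (2 + q)) ls →
             (1 + q) ^ (1 + length ls) ≤ ∑[ x ∈ l ] walks x ls d
∑-walksˡ-≥ q l [] d pal [] = begin
  (1 + q) * 1          ≡⟨ *-identityʳ (1 + q) ⟩
  1 + q                ≤⟨ 1+q≤∑δᶜ q l d pal ⟩
  ∑ l (δᶜ d)           ≡⟨ ∑-cong l (δᶜ-sym d) ⟩
  ∑[ x ∈ l ] δᶜ x d    ∎
  where open ≤-Reasoning
∑-walksˡ-≥ q l (l′ ∷ ls) d pal (pal′ ∷ pals) = begin
  (1 + q) * (1 + q) ^ (1 + length ls)              ≡⟨ *-comm (1 + q) _ ⟩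
  (1 + q) ^ (1 + length ls) * (1 + q)              ≤⟨ *-monoˡ-≤ (1 + q) (∑-walksˡ-≥ q l′ ls d pal′ pals) ⟩
  ∑[ y ∈ l′ ] walks y ls d * (1 + q)               ≤⟨ ∑*≤∑* l′ (1 + q) (λ y → walks y ls d) into into≥ ⟩
  ∑[ y ∈ l′ ] (walks y ls d * into y)              ≡⟨ ∑-cong l′ (λ y → *-comm (walks y ls d) (into y)) ⟩
  ∑[ y ∈ l′ ] (into y * walks y ls d)              ≡⟨ ∑-cong l′ (λ y → ∑-*ʳ l (walks y ls d) (λ x → δᶜ x y)) ⟨
  ∑[ y ∈ l′ ] ∑[ x ∈ l ] (δᶜ x y * walks y ls d)   ≡⟨ ∑-comm l l′ _ ⟨
  ∑[ x ∈ l ] walks x (l′ ∷ ls) d                   ∎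
  where
  open ≤-Reasoning
  into : ℕ → ℕ
  into y = ∑[ x ∈ l ] δᶜ x y
  into≥ : ∀ y → 1 + q ≤ into y
  into≥ y = ≤-trans (1+q≤∑δᶜ q l y pal) (≤-reflexive (∑-cong l (δᶜ-sym y)))

∑-walksʳ-≥ : ∀ q V Ls c → Palette (2 + q) V → All (Palette (2 + q)) Ls →
             (1 + q) ^ (1 + length Ls) ≤ ∑[ d ∈ V ] walks c Ls d
∑-walksʳ-≥ q V [] c palV [] = ≤-trans (≤-reflexive (*-identityʳ (1 + q))) (1+q≤∑δᶜ q V c palV)
∑-walksʳ-≥ q V (l ∷ ls) c palV (pal ∷ pals) = begin
  (1 + q) * (1 + q) ^ (1 + length ls)                  ≤⟨ *-monoˡ-≤ _ (1+q≤∑δᶜ q l c pal) ⟩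
  ∑ l (δᶜ c) * (1 + q) ^ (1 + length ls)
    ≤⟨ ∑*≤∑* l _ (δᶜ c) (λ x → ∑[ d ∈ V ] walks x ls d) (λ x → ∑-walksʳ-≥ q V ls x palV pals) ⟩
  ∑[ x ∈ l ] (δᶜ c x * ∑[ d ∈ V ] walks x ls d)        ≡⟨ ∑-cong l (λ x → ∑-*ˡ V (δᶜ c x) (λ d → walks x ls d)) ⟨
  ∑[ x ∈ l ] ∑[ d ∈ V ] (δᶜ c x * walks x ls d)        ≡⟨ ∑-comm l V _ ⟩
  ∑[ d ∈ V ] walks c (l ∷ ls) d                        ∎
  where open ≤-Reasoning

-- Paths with an odd number of internal vertices

odd : ℕ → ℕ
odd zero    = 1
odd (suc i) = 2 + odd i

2*[1+i]∸1≡odd : ∀ i → 2 * suc i ∸ 1 ≡ odd i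
2*[1+i]∸1≡odd i = trans (cong (_∸ 1) (*-suc 2 i)) (sym (odd≡1+2* i))
  where
  odd≡1+2* : ∀ i → odd i ≡ 1 + 2 * i
  odd≡1+2* zero    = refl
  odd≡1+2* (suc i) = trans (cong (2 +_) (odd≡1+2* i)) (cong suc (sym (*-suc 2 i)))

-- α q i counts the colourings, from a palette of q + 2 colours, of a path through
-- odd i internal vertices whose two ends carry fixed distinct colours of the palette.
α : ℕ → ℕ → ℕ
α q zero    = q
α q (suc i) = (1 + q) * (1 + q) * α q i + q

β : ℕ → ℕ → ℕ
β q i = (2 + q) * α q i + 1

[1+q]^[1+odd]≡β : ∀ q i → (1 + q) ^ (1 + odd i) ≡ β q i
[1+q]^[1+odd]≡β q zero = ring q
  where
  ring : ∀ q → (1 + q) * ((1 + q) * 1) ≡ (2 + q) * q + 1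
  ring = solve-∀
[1+q]^[1+odd]≡β q (suc i) = begin
  (1 + q) * ((1 + q) * (1 + q) ^ (1 + odd i))   ≡⟨ cong (λ z → (1 + q) * ((1 + q) * z)) ([1+q]^[1+odd]≡β q i) ⟩
  (1 + q) * ((1 + q) * ((2 + q) * α q i + 1))   ≡⟨ ring q (α q i) ⟩
  β q (suc i)                                   ∎
  where
  open ≡-Reasoning
  ring : ∀ q a → (1 + q) * ((1 + q) * ((2 + q) * a + 1)) ≡ (2 + q) * ((1 + q) * (1 + q) * a + q) + 1
  ring = solve-∀

q≤α : ∀ q i → q ≤ α q i
q≤α q zero    = ≤-refl
q≤α q (suc i) = m≤n+m q _

3≤α : ∀ q i → 1 ≤ q → 3 ≤ α q (suc i)
3≤α q i 1≤q = +-mono-≤ {2} {_} {1} 2≤ 1≤q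
  where
  2≤ : 2 ≤ (1 + q) * (1 + q) * α q i
  2≤ = *-mono-≤ {2} {_} {1} (≤-trans (s≤s 1≤q) (m≤m*n (1 + q) (1 + q))) (≤-trans 1≤q (q≤α q i))

module OddPath (q i : ℕ) {ls : List (List ℕ)}
  (pals : All (Palette (2 + q)) ls) (|ls|≡odd : length ls ≡ odd i) where

  β≡ : (1 + q) ^ (1 + length ls) ≡ β q i
  β≡ = trans (cong (λ n → (1 + q) ^ (1 + n)) |ls|≡odd) ([1+q]^[1+odd]≡β q i)

  β≤∑walksˡ : ∀ l d → Palette (2 + q) l → β q i ≤ ∑[ x ∈ l ] walks x ls d
  β≤∑walksˡ l d pal = ≤-trans (≤-reflexive (sym β≡)) (∑-walksˡ-≥ q l ls d pal pals)

  β≤∑walksʳ : ∀ V c → Palette (2 + q) V → β q i ≤ ∑[ d ∈ V ] walks c ls d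
  β≤∑walksʳ V c palV = ≤-trans (≤-reflexive (sym β≡)) (∑-walksʳ-≥ q V ls c palV pals)

-- If c ∈ l₁, then c ∉ l₂ puts c into l₁ ∖ l₂, which has as many elements as l₂ ∖ l₁,
-- while c ∈ l₂ makes the term at y = c equal to 1.
1≤∑excess : ∀ q c l₁ l₂ → Palette (2 + q) l₁ → Palette (2 + q) l₂ → 1 ≤ ∑ l₂ (excess l₁ c)
1≤∑excess q c l₁ l₂ (u₁ , |l₁|) (u₂ , |l₂|) with occ≡1⊎occᶜ≡1 c l₁ u₁
... | inj₂ (_ , c∉l₁) = begin
  1                      ≤⟨ s≤s z≤n ⟩
  2 + q                  ≡⟨ trans (*-identityʳ _) |l₂| ⟨
  length l₂ * 1          ≤⟨ length*≤∑ l₂ 1 (excess l₁ c) (λ y → ≤-trans (≤-reflexive (sym c∉l₁)) (≤-trans (m≤m+n _ _) (m≤m+n _ _))) ⟩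
  ∑ l₂ (excess l₁ c)     ∎
  where open ≤-Reasoning
... | inj₁ (c∈l₁ , _) = begin
  1                                                   ≡⟨ occ+occᶜ≡1 c l₂ u₂ ⟨
  occ c l₂ + occᶜ c l₂                                ≡⟨ +-comm (occ c l₂) _ ⟩
  occᶜ c l₂ + occ c l₂                                ≡⟨ cong₂ _+_ (sym (trans (cong (_* occᶜ c l₂) c∈l₁) (*-identityˡ _)))
                                                                   (sym (trans (cong (occ c l₂ *_) c∈l₁) (*-identityʳ _))) ⟩
  occ c l₁ * occᶜ c l₂ + occ c l₂ * occ c l₁          ≤⟨ +-monoˡ-≤ _ (occ*≤∑ l₁ c (λ y → occᶜ y l₂)) ⟩
  ∣ l₁ ∖ l₂ ∣ + occ c l₂ * occ c l₁
    ≡⟨ cong₂ _+_ (∣∖∣-comm l₁ l₂ u₁ u₂ (trans |l₁| (sym |l₂|))) (sym (∑δ*≡occ* l₂ c (λ _ → occ c l₁))) ⟩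
  ∣ l₂ ∖ l₁ ∣ + ∑[ y ∈ l₂ ] (δ c y * occ c l₁)        ≡⟨ ∑-distrib-+ l₂ (λ y → occᶜ y l₁) (λ y → δ c y * occ c l₁) ⟨
  ∑[ y ∈ l₂ ] (occᶜ y l₁ + δ c y * occ c l₁)
    ≤⟨ ∑-mono-≤ l₂ (λ y → ≤-trans (m≤n+m _ (occᶜ c l₁)) (≤-reflexive (sym (+-assoc (occᶜ c l₁) _ _)))) ⟩
  ∑ l₂ (excess l₁ c)                                  ∎
  where open ≤-Reasoning

α≤walks : ∀ q i Ls c d → All (Palette (2 + q)) Ls → length Ls ≡ odd i → α q i ≤ walks c Ls d
α≤walks q zero (l ∷ []) c d (pal ∷ []) refl =
  ≤-trans (m≤m+n q (excess l c d)) (≤-reflexive (sym (avoiding≡q+excess q l c d pal)))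
α≤walks q (suc i) (l₁ ∷ l₂ ∷ ls) c d (pal₁ ∷ pal₂ ∷ pals) |Ls|≡odd = begin
  (1 + q) * (1 + q) * α q i + q                                       ≡⟨ ring q (α q i) ⟩
  q * β q i + α q i * 1
    ≤⟨ +-mono-≤ (*-monoʳ-≤ q (β≤∑walksˡ l₂ d pal₂)) (*-monoʳ-≤ (α q i) (1≤∑excess q c l₁ l₂ pal₁ pal₂)) ⟩
  q * ∑[ y ∈ l₂ ] walks y ls d + α q i * ∑ l₂ (excess l₁ c)           ≤⟨ +-monoʳ-≤ _ α∑excess≤ ⟩
  q * ∑[ y ∈ l₂ ] walks y ls d + ∑[ y ∈ l₂ ] (walks y ls d * excess l₁ c y)
                                                                      ≡⟨ walks-∷∷-excess q c l₁ l₂ ls d pal₁ ⟨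
  walks c (l₁ ∷ l₂ ∷ ls) d                                            ∎
  where
  open ≤-Reasoning
  |ls|≡odd : length ls ≡ odd i
  |ls|≡odd = suc-injective (suc-injective |Ls|≡odd)
  open OddPath q i pals |ls|≡odd
  ring : ∀ q a → (1 + q) * (1 + q) * a + q ≡ q * ((2 + q) * a + 1) + a * 1
  ring = solve-∀
  α∑excess≤ : α q i * ∑ l₂ (excess l₁ c) ≤ ∑[ y ∈ l₂ ] (walks y ls d * excess l₁ c y)
  α∑excess≤ = ≤-trans (≤-reflexive (sym (∑-*ˡ l₂ (α q i) (excess l₁ c))))
                      (∑-mono-≤ l₂ (λ y → *-monoˡ-≤ (excess l₁ c y) (α≤walks q i ls y d pals |ls|≡odd)))

module ExcessSplit (P Q R : List ℕ) (M : ℕ → ℕ → ℕ) where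

  T₁ T₂ T₃ : ℕ
  T₁ = ∑[ c ∈ P ] (occᶜ c Q * ∑ R (M c))
  T₂ = ∑[ d ∈ R ] (occᶜ d Q * ∑[ c ∈ P ] M c d)
  T₃ = ∑[ c ∈ P ] (occ c Q * (occ c R * M c c))

  ∑∑*excess≡ : ∑[ c ∈ P ] ∑[ d ∈ R ] (M c d * excess Q c d) ≡ T₁ + T₂ + T₃
  ∑∑*excess≡ = begin
    ∑[ c ∈ P ] ∑[ d ∈ R ] (M c d * excess Q c d)                 ≡⟨ ∑-cong P row ⟩
    ∑[ c ∈ P ] (occᶜ c Q * ∑ R (M c) + ∑[ d ∈ R ] (M c d * occᶜ d Q) + occ c Q * (occ c R * M c c))
                                                                 ≡⟨ ∑-distrib-+₃ P _ _ _ ⟩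
    T₁ + ∑[ c ∈ P ] ∑[ d ∈ R ] (M c d * occᶜ d Q) + T₃           ≡⟨ cong (λ z → T₁ + z + T₃) columns ⟩
    T₁ + T₂ + T₃                                                 ∎
    where
    open ≡-Reasoning
    expand : ∀ m a b e o → m * (a + b + e * o) ≡ a * m + m * b + e * (m * o)
    expand = solve-∀
    reorder : ∀ r m a → r * (m * a) ≡ a * (r * m)
    reorder = solve-∀
    row : ∀ c → ∑[ d ∈ R ] (M c d * excess Q c d) ≡ occᶜ c Q * ∑ R (M c) + ∑[ d ∈ R ] (M c d * occᶜ d Q) + occ c Q * (occ c R * M c c)
    row c = begin
      ∑[ d ∈ R ] (M c d * excess Q c d)
        ≡⟨ ∑-cong R (λ d → expand (M c d) (occᶜ c Q) (occᶜ d Q) (δ c d) (occ c Q)) ⟩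
      ∑[ d ∈ R ] (occᶜ c Q * M c d + M c d * occᶜ d Q + δ c d * (M c d * occ c Q))
        ≡⟨ ∑-distrib-+₃ R _ _ _ ⟩
      ∑[ d ∈ R ] (occᶜ c Q * M c d) + ∑[ d ∈ R ] (M c d * occᶜ d Q) + ∑[ d ∈ R ] (δ c d * (M c d * occ c Q))
        ≡⟨ cong₂ (λ u v → u + ∑[ d ∈ R ] (M c d * occᶜ d Q) + v) (∑-*ˡ R (occᶜ c Q) (M c)) (∑δ*≡occ* R c (λ d → M c d * occ c Q)) ⟩
      occᶜ c Q * ∑ R (M c) + ∑[ d ∈ R ] (M c d * occᶜ d Q) + occ c R * (M c c * occ c Q)
        ≡⟨ cong (occᶜ c Q * ∑ R (M c) + ∑[ d ∈ R ] (M c d * occᶜ d Q) +_) (reorder (occ c R) (M c c) (occ c Q)) ⟩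
      occᶜ c Q * ∑ R (M c) + ∑[ d ∈ R ] (M c d * occᶜ d Q) + occ c Q * (occ c R * M c c) ∎
    columns : ∑[ c ∈ P ] ∑[ d ∈ R ] (M c d * occᶜ d Q) ≡ ∑[ d ∈ R ] (occᶜ d Q * ∑[ c ∈ P ] M c d)
    columns = trans (∑-comm P R _) (∑-cong R (λ d → trans (∑-*ʳ P (occᶜ d Q) (λ c → M c d)) (*-comm _ (occᶜ d Q))))

  ∣P∖Q∣*≤T₁ : ∀ k → (∀ c → k ≤ ∑ R (M c)) → ∣ P ∖ Q ∣ * k ≤ T₁
  ∣P∖Q∣*≤T₁ k k≤ = ∑*≤∑* P k (λ c → occᶜ c Q) (λ c → ∑ R (M c)) k≤

  ∣R∖Q∣*≤T₂ : ∀ k → (∀ d → k ≤ ∑[ c ∈ P ] M c d) → ∣ R ∖ Q ∣ * k ≤ T₂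
  ∣R∖Q∣*≤T₂ k k≤ = ∑*≤∑* R k (λ d → occᶜ d Q) (λ d → ∑[ c ∈ P ] M c d) k≤

  ∣P∩Q∩R∣*≤T₃ : ∀ k → (∀ c → k ≤ M c c) → ∣ P ∩ Q ∩ R ∣ * k ≤ T₃
  ∣P∩Q∩R∣*≤T₃ k k≤ = ≤-trans (∑*≤∑* P k (λ c → occ c Q * occ c R) (λ c → M c c) k≤)
                            (≤-reflexive (∑-cong P (λ c → *-assoc (occ c Q) (occ c R) (M c c))))

diagonal-step-arith : ∀ q a s t → 1 ≤ a → 1 ≤ s → 2 + q ≤ s + t →
  (2 + q) * (1 + ((1 + q) * (1 + q) * a + q)) ≤ q * ((2 + q) * ((2 + q) * a + 1)) + (s * ((2 + q) * a + 1) + t * a)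
diagonal-step-arith q (suc a) (suc s) t _ _ 2+q≤s+t = begin
  LHS                                                  ≤⟨ m≤m+n LHS ((1 + q) * a) ⟩
  LHS + (1 + q) * a                                    ≡⟨ ring q a ⟩
  q * ((2 + q) * K) + (K + (1 + q) * suc a)            ≤⟨ +-monoʳ-≤ (q * ((2 + q) * K)) (+-monoʳ-≤ K (*-monoˡ-≤ (suc a) (≤-pred 2+q≤s+t))) ⟩
  q * ((2 + q) * K) + (K + (s + t) * suc a)            ≡⟨ cong (λ z → q * ((2 + q) * K) + (K + z)) (*-distribʳ-+ (suc a) s t) ⟩
  q * ((2 + q) * K) + (K + (s * suc a + t * suc a))
    ≤⟨ +-monoʳ-≤ (q * ((2 + q) * K)) (+-monoʳ-≤ K (+-monoˡ-≤ (t * suc a) (*-monoʳ-≤ s a≤K))) ⟩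
  q * ((2 + q) * K) + (K + (s * K + t * suc a))        ≡⟨ cong (q * ((2 + q) * K) +_) (+-assoc K (s * K) (t * suc a)) ⟨
  q * ((2 + q) * K) + (suc s * K + t * suc a)          ∎
  where
  open ≤-Reasoning
  K = (2 + q) * suc a + 1
  LHS = (2 + q) * (1 + ((1 + q) * (1 + q) * suc a + q))
  a≤K : suc a ≤ K
  a≤K = ≤-trans (m≤n*m (suc a) (2 + q)) (m≤m+n _ 1)
  ring : ∀ q a → (2 + q) * (1 + ((1 + q) * (1 + q) * suc a + q)) + (1 + q) * a ≡
                 q * ((2 + q) * ((2 + q) * suc a + 1)) + (((2 + q) * suc a + 1) + (1 + q) * suc a)
  ring = solve-∀

module DiagonalStep (q i : ℕ) {l₁ l₂ V : List ℕ} {ls : List (List ℕ)}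
  (pal₁ : Palette (2 + q) l₁) (pal₂ : Palette (2 + q) l₂) (pals : All (Palette (2 + q)) ls)
  (|ls|≡odd : length ls ≡ odd i) (palV : Palette (2 + q) V) where

  open OddPath q i pals |ls|≡odd

  W : ℕ → ℕ → ℕ
  W c y = walks y ls c

  open ExcessSplit V l₁ l₂ W

  A : ℕ
  A = ∑[ c ∈ V ] ∑ l₂ (W c)

  decomposition : ∑[ c ∈ V ] walks c (l₁ ∷ l₂ ∷ ls) c ≡ q * A + (T₁ + T₂ + T₃)
  decomposition = begin
    ∑[ c ∈ V ] walks c (l₁ ∷ l₂ ∷ ls) c
      ≡⟨ ∑-cong V (λ c → walks-∷∷-excess q c l₁ l₂ ls c pal₁) ⟩
    ∑[ c ∈ V ] (q * ∑ l₂ (W c) + ∑[ y ∈ l₂ ] (W c y * excess l₁ c y))                ≡⟨ ∑-distrib-+ V _ _ ⟩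
    ∑[ c ∈ V ] (q * ∑ l₂ (W c)) + ∑[ c ∈ V ] ∑[ y ∈ l₂ ] (W c y * excess l₁ c y)     ≡⟨ cong₂ _+_ (∑-*ˡ V q _) ∑∑*excess≡ ⟩
    q * A + (T₁ + T₂ + T₃)                                                           ∎
    where open ≡-Reasoning

  [2+q]β≤A : (2 + q) * β q i ≤ A
  [2+q]β≤A = ≤-trans (≤-reflexive (cong (_* β q i) (sym (proj₂ palV)))) (length*≤∑ V (β q i) _ (λ c → β≤∑walksˡ l₂ c pal₂))

  step-V∪l₂⊆l₁ : ∣ V ∖ l₁ ∣ + ∣ l₂ ∖ l₁ ∣ ≡ 0 → (2 + q) * (1 + α q i) ≤ ∑[ c ∈ V ] W c c →
                 (2 + q) * (1 + α q (suc i)) ≤ ∑[ c ∈ V ] walks c (l₁ ∷ l₂ ∷ ls) c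
  step-V∪l₂⊆l₁ V∪l₂⊆l₁ IH = begin
    (2 + q) * (1 + α q (suc i))                     ≡⟨ ring q (α q i) ⟩
    q * ((2 + q) * β q i) + (2 + q) * (1 + α q i)   ≤⟨ +-mono-≤ (*-monoʳ-≤ q [2+q]β≤A) (≤-trans IH (≤-reflexive (sym T₃≡))) ⟩
    q * A + T₃                                      ≤⟨ +-monoʳ-≤ (q * A) (m≤n+m T₃ (T₁ + T₂)) ⟩
    q * A + (T₁ + T₂ + T₃)                          ≡⟨ decomposition ⟨
    ∑[ c ∈ V ] walks c (l₁ ∷ l₂ ∷ ls) c             ∎
    where
    open ≤-Reasoning
    ring : ∀ q a → (2 + q) * (1 + ((1 + q) * (1 + q) * a + q)) ≡ q * ((2 + q) * ((2 + q) * a + 1)) + (2 + q) * (1 + a)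
    ring = solve-∀
    V⊆l₁ : ∣ V ∖ l₁ ∣ ≡ 0
    V⊆l₁ = m+n≡0⇒m≡0 ∣ V ∖ l₁ ∣ V∪l₂⊆l₁
    V⊆l₂ : ∣ V ∖ l₂ ∣ ≡ 0
    V⊆l₂ = n≤0⇒n≡0 (begin
      ∣ V ∖ l₂ ∣                          ≡⟨ ∣∖∣≡0⇒∑occ*≡∑ V l₁ (λ c → occᶜ c l₂) (proj₁ pal₁) V⊆l₁ ⟨
      ∑[ c ∈ V ] (occ c l₁ * occᶜ c l₂)   ≤⟨ ∑occ*≤∑ V l₁ (λ c → occᶜ c l₂) (proj₁ palV) ⟩
      ∣ l₁ ∖ l₂ ∣                         ≡⟨ ∣∖∣-comm l₁ l₂ (proj₁ pal₁) (proj₁ pal₂) (trans (proj₂ pal₁) (sym (proj₂ pal₂))) ⟩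
      ∣ l₂ ∖ l₁ ∣                         ≡⟨ m+n≡0⇒n≡0 ∣ V ∖ l₁ ∣ V∪l₂⊆l₁ ⟩
      0                                   ∎)
    T₃≡ : T₃ ≡ ∑[ c ∈ V ] W c c
    T₃≡ = trans (∣∖∣≡0⇒∑occ*≡∑ V l₁ (λ c → occ c l₂ * W c c) (proj₁ pal₁) V⊆l₁)
                (∣∖∣≡0⇒∑occ*≡∑ V l₂ (λ c → W c c) (proj₁ pal₂) V⊆l₂)

  step-V∪l₂⊈l₁ : 1 ≤ q → ∣ V ∖ l₁ ∣ + ∣ l₂ ∖ l₁ ∣ ≢ 0 →
                 (2 + q) * (1 + α q (suc i)) ≤ ∑[ c ∈ V ] walks c (l₁ ∷ l₂ ∷ ls) c
  step-V∪l₂⊈l₁ 1≤q V∪l₂⊈l₁ = begin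
    (2 + q) * (1 + α q (suc i))                               ≤⟨ diagonal-step-arith q (α q i) (s₁ + s₂) t 1≤α (n≢0⇒n>0 V∪l₂⊈l₁) |V|≤ ⟩
    q * ((2 + q) * β q i) + ((s₁ + s₂) * β q i + t * α q i)   ≤⟨ +-mono-≤ (*-monoʳ-≤ q [2+q]β≤A) s₁s₂t≤T ⟩
    q * A + (T₁ + T₂ + T₃)                                    ≡⟨ decomposition ⟨
    ∑[ c ∈ V ] walks c (l₁ ∷ l₂ ∷ ls) c                       ∎
    where
    open ≤-Reasoning
    s₁ = ∣ V ∖ l₁ ∣
    s₂ = ∣ l₂ ∖ l₁ ∣
    t = ∣ V ∩ l₁ ∩ l₂ ∣
    1≤α : 1 ≤ α q i
    1≤α = ≤-trans 1≤q (q≤α q i)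
    |V|≤ : 2 + q ≤ s₁ + s₂ + t
    |V|≤ = ≤-trans (≤-reflexive (sym (proj₂ palV)))
             (length≤∣∖∣+∣∖∣+∣∩∩∣ V l₁ l₂ (proj₁ palV) (proj₁ pal₁) (proj₁ pal₂) (trans (proj₂ pal₁) (sym (proj₂ pal₂))))
    s₁s₂t≤T : (s₁ + s₂) * β q i + t * α q i ≤ T₁ + T₂ + T₃
    s₁s₂t≤T = ≤-trans (≤-reflexive (cong (_+ t * α q i) (*-distribʳ-+ (β q i) s₁ s₂)))
                (+-mono-≤ (+-mono-≤ (∣P∖Q∣*≤T₁ (β q i) (λ c → β≤∑walksˡ l₂ c pal₂)) (∣R∖Q∣*≤T₂ (β q i) (λ d → β≤∑walksʳ V d palV)))
                          (∣P∩Q∩R∣*≤T₃ (α q i) (λ c → α≤walks q i ls c c pals |ls|≡odd)))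

  step : 1 ≤ q → (2 + q) * (1 + α q i) ≤ ∑[ c ∈ V ] W c c →
         (2 + q) * (1 + α q (suc i)) ≤ ∑[ c ∈ V ] walks c (l₁ ∷ l₂ ∷ ls) c
  step 1≤q IH with ∣ V ∖ l₁ ∣ + ∣ l₂ ∖ l₁ ∣ ≟ 0
  ... | yes V∪l₂⊆l₁ = step-V∪l₂⊆l₁ V∪l₂⊆l₁ IH
  ... | no V∪l₂⊈l₁  = step-V∪l₂⊈l₁ 1≤q V∪l₂⊈l₁

∑-walks-diag-≥ : ∀ q i Ls V → 1 ≤ q → All (Palette (2 + q)) Ls → length Ls ≡ odd i → Palette (2 + q) V →
                 (2 + q) * (1 + α q i) ≤ ∑[ c ∈ V ] walks c Ls c
∑-walks-diag-≥ q zero (l ∷ []) V _ (pal ∷ []) refl (_ , |V|) = begin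
  (2 + q) * (1 + q)          ≡⟨ cong (_* (1 + q)) (sym |V|) ⟩
  length V * (1 + q)         ≤⟨ length*≤∑ V (1 + q) _ 1+q≤walks ⟩
  ∑[ c ∈ V ] walks c [ l ] c ∎
  where
  open ≤-Reasoning
  1+q≤walks : ∀ c → 1 + q ≤ walks c [ l ] c
  1+q≤walks c = begin
    1 + q               ≡⟨ +-comm 1 q ⟩
    q + 1               ≡⟨ cong (q +_) (δ-refl c) ⟨
    q + δ c c           ≤⟨ +-monoʳ-≤ q (excess≥δ l c c (proj₁ pal)) ⟩
    q + excess l c c    ≡⟨ avoiding≡q+excess q l c c pal ⟨
    walks c [ l ] c     ∎
∑-walks-diag-≥ q (suc i) (l₁ ∷ l₂ ∷ ls) V 1≤q (pal₁ ∷ pal₂ ∷ pals) |Ls|≡odd palV =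
  DiagonalStep.step q i pal₁ pal₂ pals |ls|≡odd palV 1≤q (∑-walks-diag-≥ q i ls V 1≤q pals |ls|≡odd palV)
  where
  |ls|≡odd : length ls ≡ odd i
  |ls|≡odd = suc-injective (suc-injective |Ls|≡odd)

-- The theta graph

Θ-count : List ℕ → List ℕ → List ℕ → List ℕ → List (List ℕ) → ℕ
Θ-count U V A B Ls = ∑[ c ∈ U ] ∑[ d ∈ V ] (avoiding A c d * avoiding B c d * walks c Ls d)

Θ-polynomial : ℕ → ℕ → ℕ
Θ-polynomial q i = q * q * ((2 + q) * β q i) + (q + q + 1) * ((2 + q) * (1 + α q i))

[2+q][1+α]≤β+β : ∀ q a → q ≤ a → (2 + q) * (1 + a) ≤ ((2 + q) * a + 1) + ((2 + q) * a + 1)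
[2+q][1+α]≤β+β q a q≤a = begin
  (2 + q) * (1 + a)                          ≡⟨ ring₁ q a ⟩
  2 + (q + (2 + q) * a)                      ≤⟨ +-monoʳ-≤ 2 (+-monoˡ-≤ _ (≤-trans q≤a (m≤n*m a (2 + q)))) ⟩
  2 + ((2 + q) * a + (2 + q) * a)            ≡⟨ ring₂ q a ⟩
  ((2 + q) * a + 1) + ((2 + q) * a + 1)      ∎
  where
  open ≤-Reasoning
  ring₁ : ∀ q a → (2 + q) * (1 + a) ≡ 2 + (q + (2 + q) * a)
  ring₁ = solve-∀
  ring₂ : ∀ q a → 2 + ((2 + q) * a + (2 + q) * a) ≡ ((2 + q) * a + 1) + ((2 + q) * a + 1)
  ring₂ = solve-∀

Θ-step-arith : ∀ q a r t → 1 ≤ q → 3 ≤ a → 1 ≤ r → t + r ≡ 2 + q →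
  (q + q + 1) * ((2 + q) * (1 + a)) ≤
  q * (a * (2 + q) + ((1 + q) * a + 1) * r) + q * (a * (2 + q) + ((1 + q) * a + 1) * r) + a * t
Θ-step-arith (suc p) a (suc r) t _ 3≤a _ t+r≡2+q with m≤n⇒∃[o]m+o≡n 3≤a
... | b , refl = +-cancelʳ-≤ (a * suc r) _ _ (begin
  (q + q + 1) * ((2 + q) * (1 + a)) + a * suc r              ≡⟨ cong (LHS +_) (*-suc a r) ⟩
  (q + q + 1) * ((2 + q) * (1 + a)) + (a + a * r)            ≡⟨ +-assoc LHS a (a * r) ⟨
  (q + q + 1) * ((2 + q) * (1 + a)) + a + a * r              ≤⟨ +-mono-≤ base (*-monoˡ-≤ r a≤2qZ) ⟩
  (X₁ + X₁ + a * (2 + q)) + (q * Z + q * Z) * r              ≡⟨ ring q a Z r ⟩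
  X + X + a * (2 + q)                                        ≡⟨ cong (λ n → X + X + a * n) t+r≡2+q ⟨
  X + X + a * (t + suc r)                                    ≡⟨ ring′ (X + X) a t (suc r) ⟩
  X + X + a * t + a * suc r                                  ∎)
  where
  open ≤-Reasoning
  q = suc p
  LHS = (q + q + 1) * ((2 + q) * (1 + a))
  Z = (1 + q) * a + 1
  X₁ = q * (a * (2 + q) + Z)
  X = q * (a * (2 + q) + Z * suc r)
  -- the difference of the two sides, as a polynomial in p = q − 1 and b = a − 3
  slack : ℕ
  slack = 4 * p * p + 11 * p + 2 + b * (2 * p * p + 6 * p + 3)
  base : (q + q + 1) * ((2 + q) * (1 + a)) + a ≤ X₁ + X₁ + a * (2 + q)
  base = ≤-trans (m≤m+n _ slack) (≤-reflexive (closed p b))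
    where
    closed : ∀ p b → (suc p + suc p + 1) * ((3 + p) * (4 + b)) + (3 + b) +
                     (4 * p * p + 11 * p + 2 + b * (2 * p * p + 6 * p + 3)) ≡
                     suc p * ((3 + b) * (3 + p) + ((2 + p) * (3 + b) + 1)) + suc p * ((3 + b) * (3 + p) + ((2 + p) * (3 + b) + 1)) + (3 + b) * (3 + p)
    closed = solve-∀
  a≤2qZ : a ≤ q * Z + q * Z
  a≤2qZ = ≤-trans (≤-trans (m≤m+n a (q * a)) (m≤m+n (a + q * a) 1)) (≤-trans (m≤m+n Z (p * Z)) (m≤m+n (q * Z) (q * Z)))
  ring : ∀ q a Z r → q * (a * (2 + q) + Z) + q * (a * (2 + q) + Z) + a * (2 + q) + (q * Z + q * Z) * r ≡
                     q * (a * (2 + q) + Z * suc r) + q * (a * (2 + q) + Z * suc r) + a * (2 + q)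
  ring = solve-∀
  ring′ : ∀ x a t r → x + a * (t + r) ≡ x + a * t + a * r
  ring′ = solve-∀

module ΘLowerBound (q i : ℕ) {U V : List ℕ} {Ls : List (List ℕ)}
  (palU : Palette (2 + q) U) (palV : Palette (2 + q) V) (pals : All (Palette (2 + q)) Ls)
  (|Ls|≡odd : length Ls ≡ odd i) where

  open OddPath q i pals |Ls|≡odd

  N : ℕ → ℕ → ℕ
  N c d = walks c Ls d

  Σ₀ : ℕ
  Σ₀ = ∑[ c ∈ U ] ∑ V (N c)

  Σ₁ : List ℕ → ℕ
  Σ₁ A = ∑[ c ∈ U ] ∑[ d ∈ V ] (N c d * excess A c d)

  Σ₂ : ℕ
  Σ₂ = ∑[ c ∈ U ] ∑[ d ∈ V ] (δ c d * N c d)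

  Σ₂≡ : Σ₂ ≡ ∑[ c ∈ U ] (occ c V * N c c)
  Σ₂≡ = ∑-cong U (λ c → ∑δ*≡occ* V c (N c))

  expansion≤Θ-count : ∀ A B → Palette (2 + q) A → Palette (2 + q) B →
                      q * q * Σ₀ + q * Σ₁ A + q * Σ₁ B + Σ₂ ≤ Θ-count U V A B Ls
  expansion≤Θ-count A B palA palB = begin
    q * q * Σ₀ + q * Σ₁ A + q * Σ₁ B + Σ₂
      ≡⟨ cong (_+ Σ₂) (cong₂ _+_ (cong₂ _+_ (∑∑-*ˡ U V (q * q) N) (∑∑-*ˡ U V q _)) (∑∑-*ˡ U V q _)) ⟨
    ∑[ c ∈ U ] ∑[ d ∈ V ] (q * q * N c d) + ∑[ c ∈ U ] ∑[ d ∈ V ] (q * (N c d * excess A c d))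
      + ∑[ c ∈ U ] ∑[ d ∈ V ] (q * (N c d * excess B c d)) + Σ₂
      ≡⟨ cong (_+ Σ₂) (trans (∑∑-distrib-+ U V _ _) (cong (_+ _) (∑∑-distrib-+ U V _ _))) ⟨
    ∑[ c ∈ U ] ∑[ d ∈ V ] (q * q * N c d + q * (N c d * excess A c d) + q * (N c d * excess B c d)) + Σ₂
      ≡⟨ ∑∑-distrib-+ U V _ _ ⟨
    ∑[ c ∈ U ] ∑[ d ∈ V ] (q * q * N c d + q * (N c d * excess A c d) + q * (N c d * excess B c d) + δ c d * N c d)
      ≡⟨ ∑-cong U (λ c → ∑-cong V (λ d → ring q (N c d) (excess A c d) (excess B c d) (δ c d))) ⟩
    ∑[ c ∈ U ] ∑[ d ∈ V ] ((q * q + q * (excess A c d + excess B c d) + δ c d) * N c d)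
      ≤⟨ ∑-mono-≤ U (λ c → ∑-mono-≤ V (λ d → *-monoˡ-≤ (N c d) (termwise c d))) ⟩
    Θ-count U V A B Ls ∎
    where
    open ≤-Reasoning
    ring : ∀ q n x y e → q * q * n + q * (n * x) + q * (n * y) + e * n ≡ (q * q + q * (x + y) + e) * n
    ring = solve-∀
    termwise : ∀ c d → q * q + q * (excess A c d + excess B c d) + δ c d ≤ avoiding A c d * avoiding B c d
    termwise c d = begin
      q * q + q * (x + y) + δ c d            ≡⟨ cong (q * q + q * (x + y) +_) (δ*δ≡δ c d) ⟨
      q * q + q * (x + y) + δ c d * δ c d
        ≤⟨ +-monoʳ-≤ (q * q + q * (x + y)) (*-mono-≤ (excess≥δ A c d (proj₁ palA)) (excess≥δ B c d (proj₁ palB))) ⟩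
      q * q + q * (x + y) + x * y            ≡⟨ ring′ q x y ⟩
      (q + x) * (q + y)                      ≡⟨ cong₂ _*_ (avoiding≡q+excess q A c d palA) (avoiding≡q+excess q B c d palB) ⟨
      avoiding A c d * avoiding B c d        ∎
      where
      x = excess A c d
      y = excess B c d
      ring′ : ∀ q x y → q * q + q * (x + y) + x * y ≡ (q + x) * (q + y)
      ring′ = solve-∀

  [2+q]β≤Σ₀ : (2 + q) * β q i ≤ Σ₀
  [2+q]β≤Σ₀ = ≤-trans (≤-reflexive (cong (_* β q i) (sym (proj₂ palU)))) (length*≤∑ U (β q i) _ (λ c → β≤∑walksʳ V c palV))

  ∣U∖A∣β≤T₁ : ∀ A → ∣ U ∖ A ∣ * β q i ≤ ExcessSplit.T₁ U A V N
  ∣U∖A∣β≤T₁ A = ExcessSplit.∣P∖Q∣*≤T₁ U A V N (β q i) (λ c → β≤∑walksʳ V c palV)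

  ∣V∖A∣β≤T₂ : ∀ A → ∣ V ∖ A ∣ * β q i ≤ ExcessSplit.T₂ U A V N
  ∣V∖A∣β≤T₂ A = ExcessSplit.∣R∖Q∣*≤T₂ U A V N (β q i) (λ d → β≤∑walksˡ U d palU)

  Σ₁-≥ : ∀ A → Palette (2 + q) A → α q i * (2 + q) + ((1 + q) * α q i + 1) * ∣ U ∖ V ∣ ≤ Σ₁ A
  Σ₁-≥ A palA = begin
    α q i * (2 + q) + ((1 + q) * α q i + 1) * ∣ U ∖ V ∣    ≤⟨ +-mono-≤ (*-monoʳ-≤ (α q i) |U|≤) (*-monoʳ-≤ ((1 + q) * α q i + 1) ∣U∖V∣≤) ⟩
    α q i * (s₁ + s₂ + t) + ((1 + q) * α q i + 1) * (s₁ + s₂) ≡⟨ ring q (α q i) s₁ s₂ t ⟩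
    s₁ * β q i + s₂ * β q i + t * α q i
      ≤⟨ +-mono-≤ (+-mono-≤ (∣U∖A∣β≤T₁ A) (∣V∖A∣β≤T₂ A)) (∣P∩Q∩R∣*≤T₃ (α q i) (λ c → α≤walks q i Ls c c pals |Ls|≡odd)) ⟩
    T₁ + T₂ + T₃                                           ≡⟨ ∑∑*excess≡ ⟨
    Σ₁ A                                                   ∎
    where
    open ≤-Reasoning
    open ExcessSplit U A V N
    s₁ = ∣ U ∖ A ∣
    s₂ = ∣ V ∖ A ∣
    t = ∣ U ∩ A ∩ V ∣
    ring : ∀ q a s₁ s₂ t → a * (s₁ + s₂ + t) + ((1 + q) * a + 1) * (s₁ + s₂) ≡ s₁ * ((2 + q) * a + 1) + s₂ * ((2 + q) * a + 1) + t * a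
    ring = solve-∀
    |U|≤ : 2 + q ≤ s₁ + s₂ + t
    |U|≤ = ≤-trans (≤-reflexive (sym (proj₂ palU)))
             (length≤∣∖∣+∣∖∣+∣∩∩∣ U A V (proj₁ palU) (proj₁ palA) (proj₁ palV) (trans (proj₂ palA) (sym (proj₂ palV))))
    t≤∣U∩V∣ : t ≤ ∣ U ∩ V ∣
    t≤∣U∩V∣ = ∑-mono-≤ U (λ c → occ*≤ c A (occ c V) (proj₁ palA))
    ∣U∖V∣≤ : ∣ U ∖ V ∣ ≤ s₁ + s₂
    ∣U∖V∣≤ = +-cancelʳ-≤ ∣ U ∩ V ∣ ∣ U ∖ V ∣ (s₁ + s₂) (begin
      ∣ U ∖ V ∣ + ∣ U ∩ V ∣   ≡⟨ +-comm ∣ U ∖ V ∣ _ ⟩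
      ∣ U ∩ V ∣ + ∣ U ∖ V ∣   ≡⟨ ∣∩∣+∣∖∣≡length U V (proj₁ palV) ⟩
      length U                ≡⟨ proj₂ palU ⟩
      2 + q                   ≤⟨ |U|≤ ⟩
      s₁ + s₂ + t             ≤⟨ +-monoʳ-≤ (s₁ + s₂) t≤∣U∩V∣ ⟩
      s₁ + s₂ + ∣ U ∩ V ∣     ∎)

  Σ₂-≥ : α q i * ∣ U ∩ V ∣ ≤ Σ₂
  Σ₂-≥ = begin
    α q i * ∣ U ∩ V ∣                ≡⟨ *-comm (α q i) ∣ U ∩ V ∣ ⟩
    ∣ U ∩ V ∣ * α q i                ≤⟨ ∑*≤∑* U (α q i) (λ c → occ c V) (λ c → N c c) (λ c → α≤walks q i Ls c c pals |Ls|≡odd) ⟩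
    ∑[ c ∈ U ] (occ c V * N c c)     ≡⟨ Σ₂≡ ⟨
    Σ₂                               ∎
    where open ≤-Reasoning

  module _ (1≤q : 1 ≤ q) (U⊆V : ∣ U ∖ V ∣ ≡ 0) where

    ∑N-diag≡ : ∑[ c ∈ U ] (occ c V * N c c) ≡ ∑[ c ∈ U ] N c c
    ∑N-diag≡ = ∣∖∣≡0⇒∑occ*≡∑ U V (λ c → N c c) (proj₁ palV) U⊆V

    [2+q][1+α]≤∑N-diag : (2 + q) * (1 + α q i) ≤ ∑[ c ∈ U ] N c c
    [2+q][1+α]≤∑N-diag = ∑-walks-diag-≥ q i Ls U 1≤q pals |Ls|≡odd palU

    Σ₂-≥-⊆ : (2 + q) * (1 + α q i) ≤ Σ₂
    Σ₂-≥-⊆ = ≤-trans [2+q][1+α]≤∑N-diag (≤-reflexive (sym (trans Σ₂≡ ∑N-diag≡)))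

    Σ₁-≥-⊆ : ∀ A → Palette (2 + q) A → (2 + q) * (1 + α q i) ≤ Σ₁ A
    Σ₁-≥-⊆ A palA with ∣ U ∖ A ∣ ≟ 0
    ... | yes U⊆A = begin
      (2 + q) * (1 + α q i)   ≤⟨ [2+q][1+α]≤∑N-diag ⟩
      ∑[ c ∈ U ] N c c        ≡⟨ trans (∣∖∣≡0⇒∑occ*≡∑ U A (λ c → occ c V * N c c) (proj₁ palA) U⊆A) ∑N-diag≡ ⟨
      T₃                      ≤⟨ m≤n+m T₃ (T₁ + T₂) ⟩
      T₁ + T₂ + T₃            ≡⟨ ∑∑*excess≡ ⟨
      Σ₁ A                    ∎
      where
      open ≤-Reasoning
      open ExcessSplit U A V N
    ... | no U⊈A = begin
      (2 + q) * (1 + α q i)                 ≤⟨ [2+q][1+α]≤β+β q (α q i) (q≤α q i) ⟩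
      β q i + β q i                         ≡⟨ cong₂ _+_ (*-identityˡ (β q i)) (*-identityˡ (β q i)) ⟨
      1 * β q i + 1 * β q i                 ≤⟨ +-mono-≤ (*-monoˡ-≤ (β q i) (n≢0⇒n>0 U⊈A)) (*-monoˡ-≤ (β q i) 1≤∣V∖A∣) ⟩
      ∣ U ∖ A ∣ * β q i + ∣ V ∖ A ∣ * β q i ≤⟨ +-mono-≤ (∣U∖A∣β≤T₁ A) (∣V∖A∣β≤T₂ A) ⟩
      T₁ + T₂                               ≤⟨ m≤m+n (T₁ + T₂) T₃ ⟩
      T₁ + T₂ + T₃                          ≡⟨ ∑∑*excess≡ ⟨
      Σ₁ A                                  ∎
      where
      open ≤-Reasoning
      open ExcessSplit U A V N
      1≤∣V∖A∣ : 1 ≤ ∣ V ∖ A ∣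
      1≤∣V∖A∣ = ≤-trans (n≢0⇒n>0 U⊈A)
                  (≤-trans (≤-reflexive (sym (∣∖∣≡0⇒∑occ*≡∑ U V (λ c → occᶜ c A) (proj₁ palV) U⊆V)))
                           (∑occ*≤∑ U V (λ c → occᶜ c A) (proj₁ palU)))

    bound-U⊆V : ∀ A B → Palette (2 + q) A → Palette (2 + q) B → Θ-polynomial q i ≤ Θ-count U V A B Ls
    bound-U⊆V A B palA palB = begin
      Θ-polynomial q i                                   ≡⟨ ring q ((2 + q) * β q i) ((2 + q) * (1 + α q i)) ⟩
      q * q * ((2 + q) * β q i) + q * ((2 + q) * (1 + α q i)) + q * ((2 + q) * (1 + α q i)) + (2 + q) * (1 + α q i)
                                                         ≤⟨ +-mono-≤ (+-mono-≤ (+-mono-≤ (*-monoʳ-≤ (q * q) [2+q]β≤Σ₀)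
                                                              (*-monoʳ-≤ q (Σ₁-≥-⊆ A palA))) (*-monoʳ-≤ q (Σ₁-≥-⊆ B palB))) Σ₂-≥-⊆ ⟩
      q * q * Σ₀ + q * Σ₁ A + q * Σ₁ B + Σ₂              ≤⟨ expansion≤Θ-count A B palA palB ⟩
      Θ-count U V A B Ls                                 ∎
      where
      open ≤-Reasoning
      ring : ∀ q x y → q * q * x + (q + q + 1) * y ≡ q * q * x + q * y + q * y + y
      ring = solve-∀

  bound-U⊈V : 1 ≤ q → 3 ≤ α q i → ∣ U ∖ V ∣ ≢ 0 →
              ∀ A B → Palette (2 + q) A → Palette (2 + q) B → Θ-polynomial q i ≤ Θ-count U V A B Ls
  bound-U⊈V 1≤q 3≤α U⊈V A B palA palB = begin
    Θ-polynomial q i                            ≤⟨ +-mono-≤ (*-monoʳ-≤ (q * q) [2+q]β≤Σ₀)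
                                                     (Θ-step-arith q (α q i) r t 1≤q 3≤α (n≢0⇒n>0 U⊈V) t+r≡2+q) ⟩
    q * q * Σ₀ + (q * X + q * X + α q i * t)    ≤⟨ +-monoʳ-≤ (q * q * Σ₀)
                                                     (+-mono-≤ (+-mono-≤ (*-monoʳ-≤ q (Σ₁-≥ A palA)) (*-monoʳ-≤ q (Σ₁-≥ B palB))) Σ₂-≥) ⟩
    q * q * Σ₀ + (q * Σ₁ A + q * Σ₁ B + Σ₂)     ≡⟨ ring (q * q * Σ₀) (q * Σ₁ A) (q * Σ₁ B) Σ₂ ⟩
    q * q * Σ₀ + q * Σ₁ A + q * Σ₁ B + Σ₂       ≤⟨ expansion≤Θ-count A B palA palB ⟩
    Θ-count U V A B Ls                          ∎
    where
    open ≤-Reasoning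
    r = ∣ U ∖ V ∣
    t = ∣ U ∩ V ∣
    X = α q i * (2 + q) + ((1 + q) * α q i + 1) * r
    t+r≡2+q : t + r ≡ 2 + q
    t+r≡2+q = trans (∣∩∣+∣∖∣≡length U V (proj₁ palV)) (proj₂ palU)
    ring : ∀ w x y z → w + (x + y + z) ≡ w + x + y + z
    ring = solve-∀

Θ-count-≥ : ∀ q i U V A B Ls → 1 ≤ q →
  Palette (2 + q) U → Palette (2 + q) V → Palette (2 + q) A → Palette (2 + q) B →
  All (Palette (2 + q)) Ls → length Ls ≡ odd (suc i) → Θ-polynomial q (suc i) ≤ Θ-count U V A B Ls
Θ-count-≥ q i U V A B Ls 1≤q palU palV palA palB pals |Ls|≡odd with ∣ U ∖ V ∣ ≟ 0
... | yes U⊆V = ΘLowerBound.bound-U⊆V q (suc i) palU palV pals |Ls|≡odd 1≤q U⊆V A B palA palB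
... | no U⊈V  = ΘLowerBound.bound-U⊈V q (suc i) palU palV pals |Ls|≡odd 1≤q (3≤α q i 1≤q) U⊈V A B palA palB

∈⇒excess≡δ : ∀ {M c d} → Unique M → c ∈ M → d ∈ M → excess M c d ≡ δ c d
∈⇒excess≡δ {M} {c} {d} uM c∈M d∈M =
  trans (cong₂ (λ u v → (1 ∸ u) + (1 ∸ v) + δ c d * u) (∈⇒occ≡1 M uM c∈M) (∈⇒occ≡1 M uM d∈M)) (*-identityʳ (δ c d))

avoiding-uniform : ∀ q {M c d} → Palette (2 + q) M → c ∈ M → d ∈ M → avoiding M c d ≡ q + δ c d
avoiding-uniform q {M} {c} {d} palM c∈M d∈M =
  trans (avoiding≡q+excess q M c d palM) (cong (q +_) (∈⇒excess≡δ (proj₁ palM) c∈M d∈M))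

walks-uniform : ∀ q i M Ls → Palette (2 + q) M → All (_≡ M) Ls → length Ls ≡ odd i →
                ∀ {c d} → c ∈ M → d ∈ M → walks c Ls d ≡ α q i + δ c d
walks-uniform q zero M (.M ∷ []) palM (refl ∷ []) refl c∈M d∈M = avoiding-uniform q palM c∈M d∈M
walks-uniform q (suc i) M (.M ∷ .M ∷ ls) palM@(uM , |M|) (refl ∷ refl ∷ ls≡M) |Ls|≡odd {c} {d} c∈M d∈M = begin
  walks c (M ∷ M ∷ ls) d                                                     ≡⟨ walks-∷∷-excess q c M M ls d palM ⟩
  q * ∑[ y ∈ M ] walks y ls d + ∑[ y ∈ M ] (walks y ls d * excess M c y)
    ≡⟨ cong₂ _+_ (cong (q *_) (∑-cong-∈ M IH)) (∑-cong-∈ M IH*excess) ⟩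
  q * ∑[ y ∈ M ] (a + δ y d) + ∑[ y ∈ M ] (δ c y * (a + δ y d))
    ≡⟨ cong₂ _+_ (cong (q *_) ∑[a+δ]≡) (∑δ*≡occ* M c (λ y → a + δ y d)) ⟩
  q * ((2 + q) * a + 1) + occ c M * (a + δ c d)
    ≡⟨ cong (λ o → q * ((2 + q) * a + 1) + o * (a + δ c d)) (∈⇒occ≡1 M uM c∈M) ⟩
  q * ((2 + q) * a + 1) + 1 * (a + δ c d)                                    ≡⟨ ring q a (δ c d) ⟩
  α q (suc i) + δ c d                                                        ∎
  where
  open ≡-Reasoning
  a = α q i
  |ls|≡odd : length ls ≡ odd i
  |ls|≡odd = suc-injective (suc-injective |Ls|≡odd)
  IH : ∀ {y} → y ∈ M → walks y ls d ≡ a + δ y d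
  IH y∈M = walks-uniform q i M ls palM ls≡M |ls|≡odd y∈M d∈M
  IH*excess : ∀ {y} → y ∈ M → walks y ls d * excess M c y ≡ δ c y * (a + δ y d)
  IH*excess {y} y∈M = trans (cong₂ _*_ (IH y∈M) (∈⇒excess≡δ uM c∈M y∈M)) (*-comm (a + δ y d) (δ c y))
  ∑[a+δ]≡ : ∑[ y ∈ M ] (a + δ y d) ≡ (2 + q) * a + 1
  ∑[a+δ]≡ = begin
    ∑[ y ∈ M ] (a + δ y d)        ≡⟨ ∑-distrib-+ M (λ _ → a) (λ y → δ y d) ⟩
    ∑[ _ ∈ M ] a + ∑[ y ∈ M ] δ y d
      ≡⟨ cong₂ _+_ (trans (∑-const M a) (cong (_* a) |M|)) (trans (∑-cong M (λ y → δ-sym y d)) (∈⇒occ≡1 M uM d∈M)) ⟩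
    (2 + q) * a + 1               ∎
  ring : ∀ q a e → q * ((2 + q) * a + 1) + 1 * (a + e) ≡ (1 + q) * (1 + q) * a + q + e
  ring = solve-∀

Θ-count-uniform : ∀ q i M Ls → Palette (2 + q) M → All (_≡ M) Ls → length Ls ≡ odd i →
                  Θ-count M M M M Ls ≡ Θ-polynomial q i
Θ-count-uniform q i M Ls palM@(uM , |M|) Ls≡M |Ls|≡odd = begin
  ∑[ c ∈ M ] ∑[ d ∈ M ] (avoiding M c d * avoiding M c d * walks c Ls d)   ≡⟨ ∑-cong-∈ M (λ c∈M → ∑-cong-∈ M (λ d∈M → term c∈M d∈M)) ⟩
  ∑[ c ∈ M ] ∑[ d ∈ M ] (q * q * a + δ c d * E)
    ≡⟨ ∑-cong M (λ c → trans (∑-distrib-+ M _ _) (cong₂ _+_ (∑-const M _) (∑-*ʳ M E (δ c)))) ⟩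
  ∑[ c ∈ M ] (length M * (q * q * a) + occ c M * E)
    ≡⟨ ∑-cong-∈ M (λ c∈M → cong (λ o → length M * (q * q * a) + o * E) (∈⇒occ≡1 M uM c∈M)) ⟩
  ∑[ c ∈ M ] (length M * (q * q * a) + 1 * E)                              ≡⟨ ∑-const M _ ⟩
  length M * (length M * (q * q * a) + 1 * E)                              ≡⟨ cong (λ m → m * (m * (q * q * a) + 1 * E)) |M| ⟩
  (2 + q) * ((2 + q) * (q * q * a) + 1 * E)                                ≡⟨ ring q a ⟩
  Θ-polynomial q i                                                         ∎
  where
  open ≡-Reasoning
  a = α q i
  E = q * q + 2 * q * a + 2 * q + a + 1
  ring : ∀ q a → (2 + q) * ((2 + q) * (q * q * a) + 1 * (q * q + 2 * q * a + 2 * q + a + 1)) ≡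
                 q * q * ((2 + q) * ((2 + q) * a + 1)) + (q + q + 1) * ((2 + q) * (1 + a))
  ring = solve-∀
  cubic : ∀ e → e ≤ 1 → (q + e) * (q + e) * (a + e) ≡ q * q * a + e * E
  cubic zero    _       = ring₀ q a
    where
    ring₀ : ∀ q a → (q + 0) * (q + 0) * (a + 0) ≡ q * q * a + 0
    ring₀ = solve-∀
  cubic (suc zero) _    = ring₁ q a
    where
    ring₁ : ∀ q a → (q + 1) * (q + 1) * (a + 1) ≡ q * q * a + 1 * (q * q + 2 * q * a + 2 * q + a + 1)
    ring₁ = solve-∀
  cubic (suc (suc _)) (s≤s ())
  term : ∀ {c d} → c ∈ M → d ∈ M → avoiding M c d * avoiding M c d * walks c Ls d ≡ q * q * a + δ c d * E
  term {c} {d} c∈M d∈M = trans (cong₂ (λ x y → x * x * y) (avoiding-uniform q palM c∈M d∈M) (walks-uniform q i M Ls palM Ls≡M |Ls|≡odd c∈M d∈M))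
                               (cubic (δ c d) (δ≤1 c d))

-- Counting proper list colourings

count : {P : List ℕ → Set} → Decidable P → List (List ℕ) → ℕ
count P? Ls = length (filter P? (choices Ls))

length-filter-map-∷ : ∀ {P : List ℕ → Set} (P? : Decidable P) x wss →
                      length (filter P? (map (x ∷_) wss)) ≡ length (filter (P? ∘ (x ∷_)) wss)
length-filter-map-∷ P? x []         = refl
length-filter-map-∷ P? x (ws ∷ wss) with does (P? (x ∷ ws))
... | true  = cong suc (length-filter-map-∷ P? x wss)
... | false = length-filter-map-∷ P? x wss

count-∷ : ∀ {P : List ℕ → Set} (P? : Decidable P) l Ls → count P? (l ∷ Ls) ≡ ∑[ x ∈ l ] count (P? ∘ (x ∷_)) Ls
count-∷ P? []      Ls = refl
count-∷ P? (x ∷ l) Ls = begin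
  length (filter P? (map (x ∷_) (choices Ls) ++ choices (l ∷ Ls)))
    ≡⟨ cong length (filter-++ P? (map (x ∷_) (choices Ls)) _) ⟩
  length (filter P? (map (x ∷_) (choices Ls)) ++ filter P? (choices (l ∷ Ls)))          ≡⟨ length-++ (filter P? (map (x ∷_) (choices Ls))) ⟩
  length (filter P? (map (x ∷_) (choices Ls))) + count P? (l ∷ Ls)
    ≡⟨ cong₂ _+_ (length-filter-map-∷ P? x (choices Ls)) (count-∷ P? l Ls) ⟩
  count (P? ∘ (x ∷_)) Ls + ∑[ y ∈ l ] count (P? ∘ (y ∷_)) Ls                          ∎
  where open ≡-Reasoning

count-[] : ∀ {P : List ℕ → Set} (P? : Decidable P) → count P? [] ≡ 𝟙 (P? [])
count-[] P? with P? []
... | yes _ = refl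
... | no _  = refl

count-cong : ∀ {P Q : List ℕ → Set} (P? : Decidable P) (Q? : Decidable Q) Ls →
             (∀ ws → length ws ≡ length Ls → P ws ⇔ Q ws) → count P? Ls ≡ count Q? Ls
count-cong P? Q? [] P⇔Q = trans (count-[] P?) (trans (𝟙-cong (P⇔Q [] refl) (P? []) (Q? [])) (sym (count-[] Q?)))
count-cong P? Q? (l ∷ Ls) P⇔Q = begin
  count P? (l ∷ Ls)                   ≡⟨ count-∷ P? l Ls ⟩
  ∑[ x ∈ l ] count (P? ∘ (x ∷_)) Ls
    ≡⟨ ∑-cong l (λ x → count-cong (P? ∘ (x ∷_)) (Q? ∘ (x ∷_)) Ls (λ ws |ws| → P⇔Q (x ∷ ws) (cong suc |ws|))) ⟩
  ∑[ x ∈ l ] count (Q? ∘ (x ∷_)) Ls   ≡⟨ count-∷ Q? l Ls ⟨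
  count Q? (l ∷ Ls)                   ∎
  where open ≡-Reasoning

count-×-dec : ∀ {A : Set} {Q : List ℕ → Set} (A? : Dec A) (Q? : Decidable Q) Ls →
              count (λ ws → A? ×-dec Q? ws) Ls ≡ 𝟙 A? * count Q? Ls
count-×-dec (yes a) Q? Ls =
  trans (count-cong _ Q? Ls (λ ws _ → mk⇔ proj₂ (a ,_))) (sym (+-identityʳ _))
count-×-dec (no ¬a) Q? Ls = cong length (filter-none (λ ws → no ¬a ×-dec Q? ws) {choices Ls} (tabulate (λ _ → ¬a ∘ proj₁)))

ProperPath : ℕ → List ℕ → ℕ → Set
ProperPath c []       d = c ≢ d
ProperPath c (w ∷ ws) d = c ≢ w × ProperPath w ws d

properPath? : ∀ c ws d → Dec (ProperPath c ws d)
properPath? c []       d = ¬? (c ≟ d)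
properPath? c (w ∷ ws) d = ¬? (c ≟ w) ×-dec properPath? w ws d

count-properPath : ∀ c Ls d → count (λ ws → properPath? c ws d) Ls ≡ walks c Ls d
count-properPath c []       d = count-[] (λ ws → properPath? c ws d)
count-properPath c (l ∷ Ls) d = trans (count-∷ (λ ws → properPath? c ws d) l Ls)
  (∑-cong l (λ x → trans (count-×-dec (¬? (c ≟ x)) (λ ws → properPath? x ws d) Ls) (cong (δᶜ c x *_) (count-properPath x Ls d))))

Proper-chain⇔ProperPath : ∀ cs i is j →
  Proper (chain (i ∷ is ++ [ j ])) cs ⇔ ProperPath (colourOf cs i) (map (colourOf cs) is) (colourOf cs j)
Proper-chain⇔ProperPath cs i []       j = mk⇔ (λ { (p ∷ []) → p }) (_∷ [])
Proper-chain⇔ProperPath cs i (k ∷ is) j =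
  mk⇔ (λ { (p ∷ ps) → p , Equivalence.to rest ps }) (λ { (p , ps) → p ∷ Equivalence.from rest ps })
  where
  rest : Proper (chain (k ∷ is ++ [ j ])) cs ⇔ ProperPath (colourOf cs k) (map (colourOf cs) is) (colourOf cs j)
  rest = Proper-chain⇔ProperPath cs k is j

map-colourOf-upTo : ∀ ws → map (colourOf ws) (upTo (length ws)) ≡ ws
map-colourOf-upTo ws = trans (map-applyUpTo (λ i → i) (colourOf ws) (length ws)) (applyUpTo-colourOf ws)
  where
  applyUpTo-colourOf : ∀ ws → applyUpTo (colourOf ws) (length ws) ≡ ws
  applyUpTo-colourOf []       = refl
  applyUpTo-colourOf (w ∷ ws) = cong (w ∷_) (applyUpTo-colourOf ws)

ProperEnds : ℕ → ℕ → ℕ → ℕ → Set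
ProperEnds c d x y = c ≢ x × x ≢ d × c ≢ y × y ≢ d

properEnds? : ∀ c d x y → Dec (ProperEnds c d x y)
properEnds? c d x y = ¬? (c ≟ x) ×-dec ¬? (x ≟ d) ×-dec ¬? (c ≟ y) ×-dec ¬? (y ≟ d)

Θ₂₂-Proper⇔ : ∀ J c d x y ws → length ws ≡ J →
  Proper (edges (Θ 2 2 (suc J))) (c ∷ d ∷ x ∷ y ∷ ws) ⇔ (ProperEnds c d x y × ProperPath c ws d)
Θ₂₂-Proper⇔ J c d x y ws refl = mk⇔
  (λ { (p₁ ∷ p₂ ∷ p₃ ∷ p₄ ∷ ps) → (p₁ , p₂ , p₃ , p₄) , subst (λ vs → ProperPath c vs d) inner (Equivalence.to long ps) })
  (λ { ((p₁ , p₂ , p₃ , p₄) , ps) → p₁ ∷ p₂ ∷ p₃ ∷ p₄ ∷ Equivalence.from long (subst (λ vs → ProperPath c vs d) (sym inner) ps) })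
  where
  cs = c ∷ d ∷ x ∷ y ∷ ws
  long : Proper (chain (0 ∷ map (4 +_) (upTo (length ws)) ++ [ 1 ])) cs ⇔
         ProperPath c (map (colourOf cs) (map (4 +_) (upTo (length ws)))) d
  long = Proper-chain⇔ProperPath cs 0 (map (4 +_) (upTo (length ws))) 1
  inner : map (colourOf cs) (map (4 +_) (upTo (length ws))) ≡ ws
  inner = trans (sym (map-∘ (upTo (length ws)))) (map-colourOf-upTo ws)

P-list-Θ₂₂ : ∀ J L → P-list (Θ 2 2 (suc J)) L ≡ Θ-count (L 0) (L 1) (L 2) (L 3) (applyUpTo (λ i → L (4 + i)) J)
P-list-Θ₂₂ J L = begin
  count Proper? (map L (upTo (4 + J)))                      ≡⟨ cong (count Proper?) (map-applyUpTo (λ i → i) L (4 + J)) ⟩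
  count Proper? (L 0 ∷ L 1 ∷ L 2 ∷ L 3 ∷ Ls)               ≡⟨ count-∷ Proper? (L 0) (L 1 ∷ L 2 ∷ L 3 ∷ Ls) ⟩
  ∑[ c ∈ L 0 ] count (Proper? ∘ (c ∷_)) (L 1 ∷ L 2 ∷ L 3 ∷ Ls)
    ≡⟨ ∑-cong (L 0) (λ c → trans (count-∷ (λ ws → Proper? (c ∷ ws)) (L 1) (L 2 ∷ L 3 ∷ Ls))
         (∑-cong (L 1) (λ d → trans (count-∷ (λ ws → Proper? (c ∷ d ∷ ws)) (L 2) (L 3 ∷ Ls))
           (∑-cong (L 2) (λ x → count-∷ (λ ws → Proper? (c ∷ d ∷ x ∷ ws)) (L 3) Ls))))) ⟩
  ∑[ c ∈ L 0 ] ∑[ d ∈ L 1 ] ∑[ x ∈ L 2 ] ∑[ y ∈ L 3 ] count (λ ws → Proper? (c ∷ d ∷ x ∷ y ∷ ws)) Ls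
    ≡⟨ ∑-cong (L 0) (λ c → ∑-cong (L 1) (λ d → trans (∑-cong (L 2) (λ x → ∑-cong (L 3) (λ y → inner c d x y))) (factor c d))) ⟩
  Θ-count (L 0) (L 1) (L 2) (L 3) Ls                        ∎
  where
  open ≡-Reasoning
  Proper? : Decidable (Proper (edges (Θ 2 2 (suc J))))
  Proper? = proper? (edges (Θ 2 2 (suc J)))
  Ls = applyUpTo (λ i → L (4 + i)) J
  inner : ∀ c d x y → count (λ ws → Proper? (c ∷ d ∷ x ∷ y ∷ ws)) Ls ≡ δᶜ c x * (δᶜ x d * (δᶜ c y * δᶜ y d)) * walks c Ls d
  inner c d x y = begin
    count (λ ws → Proper? (c ∷ d ∷ x ∷ y ∷ ws)) Ls
      ≡⟨ count-cong _ (λ ws → properEnds? c d x y ×-dec properPath? c ws d) Ls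
           (λ ws |ws| → Θ₂₂-Proper⇔ J c d x y ws (trans |ws| (length-applyUpTo _ J))) ⟩
    count (λ ws → properEnds? c d x y ×-dec properPath? c ws d) Ls
      ≡⟨ count-×-dec (properEnds? c d x y) (λ ws → properPath? c ws d) Ls ⟩
    𝟙 (properEnds? c d x y) * count (λ ws → properPath? c ws d) Ls
      ≡⟨ cong₂ _*_ 𝟙-properEnds (count-properPath c Ls d) ⟩
    δᶜ c x * (δᶜ x d * (δᶜ c y * δᶜ y d)) * walks c Ls d     ∎
    where
    𝟙-properEnds : 𝟙 (properEnds? c d x y) ≡ δᶜ c x * (δᶜ x d * (δᶜ c y * δᶜ y d))
    𝟙-properEnds = trans (𝟙-×-dec (¬? (c ≟ x)) _) (cong (δᶜ c x *_)
                     (trans (𝟙-×-dec (¬? (x ≟ d)) _) (cong (δᶜ x d *_) (𝟙-×-dec (¬? (c ≟ y)) _))))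
  factor : ∀ c d → ∑[ x ∈ L 2 ] ∑[ y ∈ L 3 ] (δᶜ c x * (δᶜ x d * (δᶜ c y * δᶜ y d)) * walks c Ls d) ≡
                   avoiding (L 2) c d * avoiding (L 3) c d * walks c Ls d
  factor c d = begin
    ∑[ x ∈ L 2 ] ∑[ y ∈ L 3 ] (δᶜ c x * (δᶜ x d * (δᶜ c y * δᶜ y d)) * w)
      ≡⟨ ∑-cong (L 2) (λ x → trans (∑-cong (L 3) (λ y → ring (δᶜ c x) (δᶜ x d) (δᶜ c y) (δᶜ y d) w)) (∑-*ˡ (L 3) (δᶜ c x * δᶜ x d) _)) ⟩
    ∑[ x ∈ L 2 ] (δᶜ c x * δᶜ x d * ∑[ y ∈ L 3 ] (δᶜ c y * δᶜ y d * w))  ≡⟨ ∑-*ʳ (L 2) _ _ ⟩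
    avoiding (L 2) c d * ∑[ y ∈ L 3 ] (δᶜ c y * δᶜ y d * w)              ≡⟨ cong (avoiding (L 2) c d *_) (∑-*ʳ (L 3) w _) ⟩
    avoiding (L 2) c d * (avoiding (L 3) c d * w)                        ≡⟨ *-assoc (avoiding (L 2) c d) _ _ ⟨
    avoiding (L 2) c d * avoiding (L 3) c d * w                          ∎
    where
    w = walks c Ls d
    ring : ∀ a b e f n → a * (b * (e * f)) * n ≡ a * b * (e * f * n)
    ring = solve-∀

Θ₂₂-isListColorFn : ∀ q i J → 1 ≤ q → J ≡ odd (suc i) →
  IsListColorFn (Θ 2 2 (suc J)) (2 + q) (P-chrom (Θ 2 2 (suc J)) (2 + q))
Θ₂₂-isListColorFn q i J 1≤q J≡odd = minimal , (λ _ → M) , uniform , refl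
  where
  G = Θ 2 2 (suc J)
  M = upTo (2 + q)
  |Ls|≡odd : ∀ f → length (applyUpTo f J) ≡ odd (suc i)
  |Ls|≡odd f = trans (length-applyUpTo f J) J≡odd
  uniform : IsMAssignment G (2 + q) (λ _ → M)
  uniform _ _ = upTo⁺ (2 + q) , length-upTo (2 + q)
  minimal : ∀ L → IsMAssignment G (2 + q) L → P-chrom G (2 + q) ≤ P-list G L
  minimal L isM = begin
    P-chrom G (2 + q)                                 ≡⟨ P-list-Θ₂₂ J (λ _ → M) ⟩
    Θ-count M M M M (applyUpTo (λ _ → M) J)
      ≡⟨ Θ-count-uniform q (suc i) M _ (uniform 0 z<s) (applyUpTo⁺₂ (λ _ → M) J (λ _ → refl)) (|Ls|≡odd _) ⟩
    Θ-polynomial q (suc i)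
      ≤⟨ Θ-count-≥ q i (L 0) (L 1) (L 2) (L 3) Ls 1≤q
           (isM 0 z<s) (isM 1 (s<s z<s)) (isM 2 (s<s (s<s z<s))) (isM 3 (s<s (s<s (s<s z<s)))) pals (|Ls|≡odd _) ⟩
    Θ-count (L 0) (L 1) (L 2) (L 3) Ls                ≡⟨ P-list-Θ₂₂ J L ⟨
    P-list G L                                        ∎
    where
    open ≤-Reasoning
    Ls = applyUpTo (λ j → L (4 + j)) J
    pals : All (Palette (2 + q)) Ls
    pals = applyUpTo⁺₁ (λ j → L (4 + j)) J (λ j<J → isM _ (+-monoʳ-< 4 j<J))

mainTheorem2 : (k : ℕ) → 2 ≤ k → (m : ℕ) → 3 ≤ m →
    IsListColorFn (Θ 2 2 (2 * k)) m (P-chrom (Θ 2 2 (2 * k)) m)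
mainTheorem2 (suc (suc i)) (s≤s (s≤s _)) (suc (suc (suc p))) (s≤s (s≤s (s≤s _))) =
  Θ₂₂-isListColorFn (suc p) i (2 * suc (suc i) ∸ 1) (s≤s z≤n) (2*[1+i]∸1≡odd (suc i))
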